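{- Let $r \ge 2$ and $k \ge 3$ be integers and let $\widehat{F}_k$ be any $r$-coloring of the edges of $K_k$. For every natural number $n$, there exists a complete multipartite graph on $n$ vertices which is $(r, \widehat{F}_k)$-extremal.
   Context: An $r$-coloring of a graph is any map from its edge set to $\{1,\dots,r\}$ (not necessarily proper). An $r$-coloring $\widehat{F}_k$ of $K_k$ is regarded as a pattern: only the partition of $E(K_k)$ into color classes matters, not the names of colors. An $r$-coloring of a graph $G$ contains $\widehat{F}_k$ if there is an injective map $\varphi$ from $V(K_k)$ to a set of $k$ pairwise adjacent vertices of $G$ such that for all edges $e,e'$ of $K_k$, $e$ and $e'$ have the same color in $\widehat{F}_k$ if and only if $\varphi(e)$ and $\varphi(e')$ have the same color in $G$; otherwise the coloring is $\widehat{F}_k$-free. $c_{r,\widehat{F}_k}(G)$ is the number of $\widehat{F}_k$-free $r$-colorings of $E(G)$, $c_{r,\widehat{F}_k}(n)$ is its maximum over all $n$-vertex graphs, and an $n$-vertex graph $G$ is $(r,\widehat{F}_k)$-extremal if $c_{r,\widehat{F}_k}(G)=c_{r,\widehat{F}_k}(n)$. -}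

module Defs where

open import Data.Nat using (ℕ; zero; suc; _≤_)
open import Data.Fin using (Fin; zero; suc; _<?_; _≟_)
open import Data.Bool using (Bool; true; false; _∧_; _∨_; not; if_then_else_)
open import Data.List.Base using (List; []; _∷_; map; concatMap; filterᵇ; length; lookup; allFin)
open import Data.Bool.ListAction using (all; any)
open import Data.Product using (Σ; _×_; _,_)
open import Relation.Binary.PropositionalEquality using (_≡_; refl) renaming (sym to ≡-sym)
open import Relation.Nullary using (yes; no)
open import Data.Empty using (⊥-elim)
open import Relation.Nullary.Decidable using (⌊_⌋)

_==_ : ∀ {n} → Fin n → Fin n → Bool
a == b = ⌊ a ≟ b ⌋

_⇔ᵇ_ : Bool → Bool → Bool
x ⇔ᵇ y = if x then y else not y

record Graph (n : ℕ) : Set where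
  field
    adj    : Fin n → Fin n → Bool
    sym    : ∀ u v → adj u v ≡ adj v u
    irrefl : ∀ u → adj u u ≡ false
open Graph public

K : (k : ℕ) → Graph k
K k = record { adj = λ u v → not (u == v) ; sym = symK ; irrefl = irreflK }
  where
  symK : ∀ u v → not (u == v) ≡ not (v == u)
  symK u v with u ≟ v | v ≟ u
  ... | yes _ | yes _ = refl
  ... | no _  | no _  = refl
  ... | yes p | no q  = ⊥-elim (q (≡-sym p))
  ... | no q  | yes p = ⊥-elim (q (≡-sym p))
  irreflK : ∀ u → not (u == u) ≡ false
  irreflK u with u ≟ u
  ... | yes _ = refl
  ... | no q  = ⊥-elim (q refl)

pairs : (n : ℕ) → List (Fin n × Fin n)
pairs n = concatMap (λ i → map (λ j → (i , j)) (allFin n)) (allFin n)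

edgeList : ∀ {n} → Graph n → List (Fin n × Fin n)
edgeList {n} G = filterᵇ (λ { (u , v) → ⌊ u <? v ⌋ ∧ adj G u v }) (pairs n)

-- Number of edges; the edges of G are indexed by Fin (e G).
e : ∀ {n} → Graph n → ℕ
e G = length (edgeList G)

ends : ∀ {n} (G : Graph n) → Fin (e G) → Fin n × Fin n
ends G p = lookup (edgeList G) p

-- An r-coloring of E(G) (arbitrary map from the edge set to {1..r} ≅ Fin r).
Coloring : ∀ {n} → ℕ → Graph n → Set
Coloring r G = Fin (e G) → Fin r

-- Enumeration of all functions Fin m → A whose values lie in the list xs
-- (with xs = allFin r, each function Fin m → Fin r appears exactly once up to extensionality).
allFuns : ∀ {A : Set} (m : ℕ) → List A → List (Fin m → A)
allFuns zero    xs = (λ ()) ∷ []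
allFuns (suc m) xs =
  concatMap (λ a → map (λ f → λ { zero → a ; (suc i) → f i }) (allFuns m xs)) xs

-- True iff there is an injective φ : Fin k → Fin n whose image is a clique of G
-- such that for all edges p, q of K_k, F̂ p = F̂ q  iff  c φ(p) = c φ(q),
-- where φ(p) is the (unique) edge p' of G with ends {φ a, φ b} for ends p = (a , b).
contains : ∀ {r n} (k : ℕ) (G : Graph n) → Coloring r (K k) → Coloring r G → Bool
contains {r} {n} k G F c = any good (allFuns k (allFin n))
  where
  good : (Fin k → Fin n) → Bool
  good φ = injective ∧ (clique ∧ match)
    where
    injective = all (λ a → all (λ b → (a == b) ∨ not (φ a == φ b)) (allFin k)) (allFin k)
    clique    = all (λ a → all (λ b → (a == b) ∨ adj G (φ a) (φ b)) (allFin k)) (allFin k)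
    covers : Fin (e G) → Fin (e (K k)) → Bool
    covers p' p with ends (K k) p | ends G p'
    ... | (a , b) | (u , v) = ((u == φ a) ∧ (v == φ b)) ∨ ((u == φ b) ∧ (v == φ a))
    match = all (λ (p : Fin (e (K k))) → all (λ (q : Fin (e (K k))) →
              all (λ (p' : Fin (e G)) → all (λ (q' : Fin (e G)) →
              not (covers p' p ∧ covers q' q) ∨ ((F p == F q) ⇔ᵇ (c p' == c q')))
              (allFin (e G))) (allFin (e G))) (allFin (e (K k)))) (allFin (e (K k)))

numFree : ∀ {n} (r k : ℕ) → Coloring r (K k) → Graph n → ℕ
numFree r k F G = length (filterᵇ (λ c → not (contains k G F c)) (allFuns (e G) (allFin r)))

Extremal : ∀ {n} (r k : ℕ) → Coloring r (K k) → Graph n → Set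
Extremal {n} r k F G = ∀ (H : Graph n) → numFree r k F H ≤ numFree r k F G

CompleteMultipartite : ∀ {n} → Graph n → Set
CompleteMultipartite {n} G =
  Σ ℕ λ m → Σ (Fin n → Fin m) λ part → ∀ u v → adj G u v ≡ not (part u == part v)

-- Zykov symmetrization. Let u and v be non-adjacent vertices of G and let c count the F̂-free
-- colourings. No copy of K_k contains both u and v, so a colouring of G is F̂-free exactly when its
-- restrictions to G − v and to G − u are. Once the colouring χ of the edges avoiding u and v is fixed,
-- the edges at u and the edges at v are coloured independently, whence c(G) = Σ_χ a(χ) b(χ), where
-- a(χ) (resp. b(χ)) counts the extensions of χ to the edges at u (resp. v) that are free in G − v
-- (resp. G − u). Making v a twin of u gives Σ_χ a(χ)², making u a twin of v gives Σ_χ b(χ)², and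
-- 2ab ≤ a² + b², so both twins of an extremal graph are extremal. Starting from an extremal graph,
-- process the vertices in order and make each one a twin of an earlier representative it is not
-- adjacent to, if there is one: the representatives stay pairwise adjacent, so the final graph is
-- complete multipartite, its parts being the twin classes.

module Submission where

open import Defs hiding (sym)

open import Level using (_⊔_; 0ℓ)
open import Data.Empty using (⊥; ⊥-elim)
open import Data.Bool using (Bool; true; false; not; _∧_; _∨_; T; if_then_else_) renaming (_≟_ to _≟ᵇ_)
open import Data.Bool.Properties using (T-∧; T-∨; T-≡; T-not-≡; ∧-comm; ∨-comm; ∧-zeroʳ; ∧-assoc; ∨-identityʳ)
open import Data.Bool.ListAction using (all)
open import Data.Nat as ℕ using (ℕ; zero; suc; _+_; _*_; _≤_; z≤n)
import Data.Nat.Properties as ℕₚ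
open import Data.Nat.ListAction using (sum)
open import Data.Nat.Solver using (module +-*-Solver)
open import Algebra.Properties.CommutativeSemigroup ℕₚ.+-commutativeSemigroup using (interchange)
open import Data.Fin using (Fin; zero; suc; toℕ; fromℕ<; _<_; _<?_; _≟_)
import Data.Fin.Properties as Fin
open import Data.Fin.Permutation.Components using (transpose)
open import Data.Product using (Σ; _×_; _,_; proj₁; proj₂)
open import Data.Product.Properties using (≡-dec)
open import Data.Sum using (_⊎_; inj₁; inj₂; [_,_]′)
open import Data.List using (List; []; _∷_; _++_; map; length; filterᵇ; lookup; allFin; concatMap; cartesianProductWith; cartesianProduct)
open import Data.List.Properties using (map-cong)
open import Data.List.Extrema.Nat using (argmax; f[xs]≤f[argmax])
open import Data.List.Relation.Unary.Any as Any using (Any; here; there; index)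
open import Data.List.Relation.Unary.Any.Properties as Anyₚ using (lookup-index; any⁺; any⁻)
open import Data.List.Relation.Unary.All as All using (All)
open import Data.List.Relation.Unary.All.Properties using (all⁺; all⁻)
open import Data.List.Relation.Unary.AllPairs as AllPairs using (_∷_; [])
open import Data.List.Relation.Unary.Enumerates.Setoid using (IsEnumeration)
open import Data.List.Relation.Unary.Unique.Propositional using () renaming (Unique to Unique≡)
import Data.List.Relation.Unary.Unique.Propositional.Properties as Uniqueₚ
import Data.List.Relation.Unary.Unique.Setoid as SetoidUnique
import Data.List.Relation.Unary.Unique.Setoid.Properties as SetoidUniqueₚ
open import Data.List.Membership.Propositional using (_∈_; find)
open import Data.List.Membership.Propositional.Properties
  using (∈-map⁺; ∈-filter⁺; ∈-filter⁻; ∈-allFin; ∈-lookup; ∈-cartesianProduct⁺)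
import Data.List.Membership.Setoid as SetoidMembership
import Data.List.Membership.Setoid.Properties as SetoidMembershipₚ
import Data.List.Membership.DecPropositional as DecMembership
open import Function using (_∘_; _⇔_; id)
open import Function.Bundles using (Equivalence; mk⇔)
open import Function.Definitions using (Congruent)
open import Relation.Binary.Bundles using (Setoid)
open import Relation.Binary.Definitions using (tri<; tri≈; tri>)
open import Relation.Binary.PropositionalEquality
  using (_≡_; _≢_; _≗_; refl; sym; trans; cong; cong₂; subst; subst₂; _→-setoid_; module ≡-Reasoning)
import Relation.Binary.PropositionalEquality as ≡
open import Relation.Nullary using (¬_; Dec; yes; no; _×-dec_)
open import Relation.Nullary.Decidable using (T?; ⌊_⌋; toWitness; fromWitness; fromWitnessFalse; dec-true; dec-false)

open Equivalence using (to; from)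

count : ∀ {a} {A : Set a} → (A → Bool) → List A → ℕ
count p xs = length (filterᵇ p xs)

module _ {A : Set} where

  count-++ : ∀ (p : A → Bool) xs ys → count p (xs ++ ys) ≡ count p xs + count p ys
  count-++ p []       ys = refl
  count-++ p (x ∷ xs) ys with p x
  ... | true  = cong suc (count-++ p xs ys)
  ... | false = count-++ p xs ys

  count-cong : ∀ (p q : A → Bool) xs → (∀ {x} → x ∈ xs → p x ≡ q x) → count p xs ≡ count q xs
  count-cong p q []       _    = refl
  count-cong p q (x ∷ xs) p≡q with p x | q x | p≡q (here refl)
  ... | true  | true  | _ = cong suc (count-cong p q xs (p≡q ∘ there))
  ... | false | false | _ = count-cong p q xs (p≡q ∘ there)

  count-map : ∀ {B : Set} (p : B → Bool) (f : A → B) xs → count p (map f xs) ≡ count (p ∘ f) xs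
  count-map p f []       = refl
  count-map p f (x ∷ xs) with p (f x)
  ... | true  = cong suc (count-map p f xs)
  ... | false = count-map p f xs

  count-const-∧ : ∀ b (q : A → Bool) xs → count (λ x → b ∧ q x) xs ≡ (if b then count q xs else 0)
  count-const-∧ true  q xs       = refl
  count-const-∧ false q []       = refl
  count-const-∧ false q (x ∷ xs) = count-const-∧ false q xs

module _ {A B C : Set} where

  count-cartesianProductWith : ∀ (p : C → Bool) (f : A → B → C) xs ys →
    count p (cartesianProductWith f xs ys) ≡ sum (map (λ x → count (p ∘ f x) ys) xs)
  count-cartesianProductWith p f []       ys = refl
  count-cartesianProductWith p f (x ∷ xs) ys = begin
    count p (map (f x) ys ++ cartesianProductWith f xs ys)
      ≡⟨ count-++ p (map (f x) ys) _ ⟩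
    count p (map (f x) ys) + count p (cartesianProductWith f xs ys)
      ≡⟨ cong₂ _+_ (count-map p (f x) ys) (count-cartesianProductWith p f xs ys) ⟩
    count (p ∘ f x) ys + sum (map (λ x → count (p ∘ f x) ys) xs) ∎
    where open ≡-Reasoning

  count-cartesianProductWith-∧ : ∀ (P : C → Bool) (p : A → Bool) (q : B → Bool) (f : A → B → C) xs ys →
    (∀ a b → P (f a b) ≡ p a ∧ q b) →
    count P (cartesianProductWith f xs ys) ≡ count p xs * count q ys
  count-cartesianProductWith-∧ P p q f xs ys P≡ =
    trans (count-cartesianProductWith P f xs ys) (product xs)
    where
    product : ∀ xs → sum (map (λ x → count (P ∘ f x) ys) xs) ≡ count p xs * count q ys
    product []       = refl
    product (x ∷ xs)
      rewrite count-cong (P ∘ f x) (λ b → p x ∧ q b) ys (λ {b} _ → P≡ x b)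
            | count-const-∧ (p x) q ys
      with p x
    ... | true  = cong (count q ys +_) (product xs)
    ... | false = product xs

  concatMap-map≡cartesianProductWith : ∀ (f : A → B → C) xs ys →
    concatMap (λ x → map (f x) ys) xs ≡ cartesianProductWith f xs ys
  concatMap-map≡cartesianProductWith f []       ys = refl
  concatMap-map≡cartesianProductWith f (x ∷ xs) ys =
    cong (map (f x) ys ++_) (concatMap-map≡cartesianProductWith f xs ys)

module _ {c ℓ} (S : Setoid c ℓ) where
  open Setoid S using (_≈_) renaming (Carrier to X; sym to ≈-sym)
  open SetoidMembership S using () renaming (_∈_ to _∈ₛ_)
  open SetoidUnique S using (Unique)

  Unique⇒lookup-injective : ∀ {xs} → Unique xs → ∀ i j → lookup xs i ≈ lookup xs j → i ≡ j
  Unique⇒lookup-injective (x≉ ∷ _)  zero    zero    _ = refl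
  Unique⇒lookup-injective (x≉ ∷ _)  zero    (suc j) x≈ = ⊥-elim (All.lookup x≉ (∈-lookup j) x≈)
  Unique⇒lookup-injective (x≉ ∷ _)  (suc i) zero    x≈ = ⊥-elim (All.lookup x≉ (∈-lookup i) (≈-sym x≈))
  Unique⇒lookup-injective (_ ∷ xs!) (suc i) (suc j) x≈ = cong suc (Unique⇒lookup-injective xs! i j x≈)

  Unique⇒length-≤ : ∀ {xs ys} → Unique xs → (∀ {x} → x ∈ₛ xs → x ∈ₛ ys) → length xs ≤ length ys
  Unique⇒length-≤ {xs} {ys} xs! xs⊆ys = Fin.injective⇒≤ {f = position} position-injective
    where
    position : Fin (length xs) → Fin (length ys)
    position i = Any.index (xs⊆ys (SetoidMembershipₚ.∈-lookup S xs i))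
    position-injective : ∀ {i j} → position i ≡ position j → i ≡ j
    position-injective {i} {j} eq = Unique⇒lookup-injective xs! i j
      (SetoidMembershipₚ.index-injective S (xs⊆ys _) (xs⊆ys _) eq)

  record IsExactEnumeration (xs : List X) : Set (c ⊔ ℓ) where
    field
      unique     : Unique xs
      enumerates : IsEnumeration S xs

  Unique⇒count-≤ : ∀ (p : X → Bool) → Congruent _≈_ _≡_ p → ∀ {xs ys} →
    Unique xs → IsEnumeration S ys → count p xs ≤ count p ys
  Unique⇒count-≤ p p-cong {xs} {ys} xs! ys-enum =
    Unique⇒length-≤ (SetoidUniqueₚ.filter⁺ S (T? ∘ p) xs!) inclusion
    where
    p-resp : ∀ {x y} → x ≈ y → T (p x) → T (p y)
    p-resp x≈y = subst T (p-cong x≈y)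
    inclusion : ∀ {x} → x ∈ₛ filterᵇ p xs → x ∈ₛ filterᵇ p ys
    inclusion x∈ with SetoidMembershipₚ.∈-filter⁻ S (T? ∘ p) p-resp {xs = xs} x∈
    ... | _ , px = SetoidMembershipₚ.∈-filter⁺ S (T? ∘ p) p-resp (ys-enum _) px

  count-invariant : ∀ (p : X → Bool) → Congruent _≈_ _≡_ p → ∀ {xs ys} →
    IsExactEnumeration xs → IsExactEnumeration ys → count p xs ≡ count p ys
  count-invariant p p-cong xs-enum ys-enum = ℕₚ.≤-antisym
    (Unique⇒count-≤ p p-cong (unique xs-enum) (enumerates ys-enum))
    (Unique⇒count-≤ p p-cong (unique ys-enum) (enumerates xs-enum))
    where open IsExactEnumeration

module _ {A : Set} where

  allFuns⁺ : ∀ {B : Set} (R : A → B → Set) m xs (g : Fin m → B) →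
    (∀ i → Any (λ a → R a (g i)) xs) → Any (λ f → ∀ i → R (f i) (g i)) (allFuns m xs)
  allFuns⁺ R zero    xs g _ = here λ ()
  allFuns⁺ R (suc m) xs g R-g = Anyₚ.concatMap⁺ _ (Any.map (λ R-a → Anyₚ.map⁺
    (Any.map (λ R-f → λ { zero → R-a ; (suc i) → R-f i }) (allFuns⁺ R m xs (g ∘ suc) (R-g ∘ suc))))
    (R-g zero))

  allFuns-unique : ∀ m {xs} → SetoidUnique.Unique (≡.setoid A) xs →
    SetoidUnique.Unique (Fin m →-setoid A) (allFuns m xs)
  allFuns-unique zero    _   = All.[] ∷ []
  allFuns-unique (suc m) {xs} xs! = subst (SetoidUnique.Unique (Fin (suc m) →-setoid A))
    (sym (concatMap-map≡cartesianProductWith _ xs (allFuns m xs)))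
    (SetoidUniqueₚ.cartesianProductWith⁺ (≡.setoid A) (Fin m →-setoid A) (Fin (suc m) →-setoid A)
      _ (λ eq → eq zero , eq ∘ suc) xs! (allFuns-unique m xs!))

2ab≤a²+b² : ∀ a b → 2 * (a * b) ≤ a * a + b * b
2ab≤a²+b² a b = [ ordered , swapped ]′ (ℕₚ.≤-total a b)
  where
  open +-*-Solver
  expansion : ∀ a t → a * a + (a + t) * (a + t) ≡ 2 * (a * (a + t)) + t * t
  expansion = solve 2 (λ a t → a :* a :+ (a :+ t) :* (a :+ t) := con 2 :* (a :* (a :+ t)) :+ t :* t) refl
  ordered : ∀ {a b} → a ≤ b → 2 * (a * b) ≤ a * a + b * b
  ordered {a} a≤b with t , refl ← ℕₚ.m≤n⇒∃[o]m+o≡n a≤b =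
    subst (2 * (a * (a + t)) ≤_) (sym (expansion a t)) (ℕₚ.m≤m+n _ (t * t))
  swapped : b ≤ a → 2 * (a * b) ≤ a * a + b * b
  swapped b≤a = subst₂ _≤_ (cong (2 *_) (ℕₚ.*-comm b a)) (ℕₚ.+-comm (b * b) (a * a)) (ordered b≤a)

sum-2ab≤a²+b² : ∀ {A : Set} (f g : A → ℕ) xs →
  2 * sum (map (λ x → f x * g x) xs) ≤ sum (map (λ x → f x * f x) xs) + sum (map (λ x → g x * g x) xs)
sum-2ab≤a²+b² f g []       = z≤n
sum-2ab≤a²+b² f g (x ∷ xs) = begin
  2 * (f x * g x + sum (map (λ x → f x * g x) xs))
    ≡⟨ ℕₚ.*-distribˡ-+ 2 (f x * g x) _ ⟩
  2 * (f x * g x) + 2 * sum (map (λ x → f x * g x) xs)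
    ≤⟨ ℕₚ.+-mono-≤ (2ab≤a²+b² (f x) (g x)) (sum-2ab≤a²+b² f g xs) ⟩
  (f x * f x + g x * g x) + (sum (map (λ x → f x * f x) xs) + sum (map (λ x → g x * g x) xs))
    ≡⟨ interchange (f x * f x) (g x * g x) _ _ ⟩
  (f x * f x + sum (map (λ x → f x * f x) xs)) + (g x * g x + sum (map (λ x → g x * g x) xs)) ∎
  where open ℕₚ.≤-Reasoning

⌊⌋-yes : ∀ {A : Set} (a? : Dec A) → A → ⌊ a? ⌋ ≡ true
⌊⌋-yes a? a = to T-≡ (fromWitness a)

⌊⌋-no : ∀ {A : Set} (a? : Dec A) → ¬ A → ⌊ a? ⌋ ≡ false
⌊⌋-no a? ¬a = to T-not-≡ (fromWitnessFalse ¬a)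

T-⇔⇒≡ : ∀ {a b} → (T a → T b) → (T b → T a) → a ≡ b
T-⇔⇒≡ {true}  {true}  _ _ = refl
T-⇔⇒≡ {true}  {false} f _ = ⊥-elim (f _)
T-⇔⇒≡ {false} {true}  _ g = ⊥-elim (g _)
T-⇔⇒≡ {false} {false} _ _ = refl

not-∨ : ∀ x y → not (x ∨ y) ≡ not x ∧ not y
not-∨ true  _ = refl
not-∨ false _ = refl

∧-guard : ∀ {a b} q → (T q → a ≡ b) → a ∧ q ≡ b ∧ q
∧-guard {a} {b} true  a≡b = cong (_∧ true) (a≡b _)
∧-guard {a} {b} false _   = trans (∧-zeroʳ a) (sym (∧-zeroʳ b))

⇔ᵇ-≡ : ∀ {x y} → T (x ⇔ᵇ y) ⇔ (x ≡ y)
⇔ᵇ-≡ {true}  {true}  = mk⇔ (λ _ → refl) _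
⇔ᵇ-≡ {false} {false} = mk⇔ (λ _ → refl) _
⇔ᵇ-≡ {true}  {false} = mk⇔ (λ ()) (λ ())
⇔ᵇ-≡ {false} {true}  = mk⇔ (λ ()) (λ ())

not-∨⇔ : ∀ {x y} → T (not x ∨ y) ⇔ (T x → T y)
not-∨⇔ {true}  = mk⇔ (λ t _ → t) (λ f → f _)
not-∨⇔ {false} = mk⇔ (λ _ ()) _

module _ {n : ℕ} where

  ==⇒≡ : ∀ {a b : Fin n} → T (a == b) → a ≡ b
  ==⇒≡ = toWitness

  ≡⇒== : ∀ {a b : Fin n} → a ≡ b → T (a == b)
  ≡⇒== = fromWitness

  all-allFin⁻ : ∀ (p : Fin n → Bool) → T (all p (allFin n)) → ∀ i → T (p i)
  all-allFin⁻ p t i = All.lookup (all⁺ p (allFin n) t) (∈-allFin i)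

  all-allFin⁺ : ∀ (p : Fin n → Bool) → (∀ i → T (p i)) → T (all p (allFin n))
  all-allFin⁺ p h = all⁻ p {xs = allFin n} (All.tabulate (λ {i} _ → h i))

  ==-∨⇔ : ∀ {a b : Fin n} {X} → T ((a == b) ∨ X) ⇔ (a ≢ b → T X)
  ==-∨⇔ {a} {b} {X} = mk⇔ sound complete
    where
    sound : T ((a == b) ∨ X) → a ≢ b → T X
    sound t a≢b with to T-∨ t
    ... | inj₁ a=b = ⊥-elim (a≢b (==⇒≡ a=b))
    ... | inj₂ x   = x
    complete : (a ≢ b → T X) → T ((a == b) ∨ X)
    complete f with a ≟ b
    ... | yes _   = _
    ... | no  a≢b = f a≢b

  not-==⇔ : ∀ {a b : Fin n} → T (not (a == b)) ⇔ (a ≢ b)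
  not-==⇔ {a} {b} = mk⇔ (λ t a≡b → subst (T ∘ not) (⌊⌋-yes (a ≟ b) a≡b) t)
                        (λ a≢b → subst (T ∘ not) (sym (⌊⌋-no (a ≟ b) a≢b)) _)

  ==-injective : ∀ {f : Fin n → Fin n} → (∀ {x y} → f x ≡ f y → x ≡ y) → ∀ x y → (f x == f y) ≡ (x == y)
  ==-injective {f} f-injective x y = T-⇔⇒≡ (≡⇒== ∘ f-injective ∘ ==⇒≡) (≡⇒== ∘ cong f ∘ ==⇒≡)

involutive⇒injective : ∀ {n} {τ : Fin n → Fin n} → (∀ x → τ (τ x) ≡ x) → ∀ {x y} → τ x ≡ τ y → x ≡ y
involutive⇒injective {τ = τ} τ-involutive {x} {y} eq =
  trans (sym (τ-involutive x)) (trans (cong τ eq) (τ-involutive y))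

-- Edge sets and operations on graphs

EdgeSet : ℕ → Set
EdgeSet n = Fin n → Fin n → Bool

_⊆_ : ∀ {n} → EdgeSet n → EdgeSet n → Set
S ⊆ S′ = ∀ x y → T (S x y) → T (S′ x y)

module _ {n : ℕ} where

  _∪_ : EdgeSet n → EdgeSet n → EdgeSet n
  (S₁ ∪ S₂) x y = S₁ x y ∨ S₂ x y

  Symmetric : EdgeSet n → Set
  Symmetric S = ∀ x y → S x y ≡ S y x

  Disjoint : EdgeSet n → EdgeSet n → Set
  Disjoint S₁ S₂ = ∀ x y → T (S₁ x y) → T (S₂ x y) → ⊥

  ∪-⊆ˡ : ∀ S₁ S₂ → S₁ ⊆ (S₁ ∪ S₂)
  ∪-⊆ˡ S₁ S₂ x y = from (T-∨ {S₁ x y}) ∘ inj₁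

  ∪-⊆ʳ : ∀ S₁ S₂ → S₂ ⊆ (S₁ ∪ S₂)
  ∪-⊆ʳ S₁ S₂ x y = from (T-∨ {S₁ x y}) ∘ inj₂

  ≐⇒⊆ : ∀ {S S′ : EdgeSet n} → (∀ x y → S x y ≡ S′ x y) → S ⊆ S′
  ≐⇒⊆ S≡S′ x y = subst T (S≡S′ x y)

  ⊆-trans : ∀ {S₁ S₂ S₃ : EdgeSet n} → S₁ ⊆ S₂ → S₂ ⊆ S₃ → S₁ ⊆ S₃
  ⊆-trans S₁⊆S₂ S₂⊆S₃ x y = S₂⊆S₃ x y ∘ S₁⊆S₂ x y

  ∪-mono : ∀ {S₁ S₁′ S₂ S₂′ : EdgeSet n} → S₁ ⊆ S₁′ → S₂ ⊆ S₂′ → (S₁ ∪ S₂) ⊆ (S₁′ ∪ S₂′)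
  ∪-mono {S₁} {S₁′} {S₂} {S₂′} S₁⊆ S₂⊆ x y xy with to (T-∨ {S₁ x y}) xy
  ... | inj₁ xy₁ = ∪-⊆ˡ S₁′ S₂′ x y (S₁⊆ x y xy₁)
  ... | inj₂ xy₂ = ∪-⊆ʳ S₁′ S₂′ x y (S₂⊆ x y xy₂)

  Disjoint-⊆ : ∀ {S₁ S₁′ S₂ S₂′ : EdgeSet n} → S₁′ ⊆ S₁ → S₂′ ⊆ S₂ → Disjoint S₁ S₂ → Disjoint S₁′ S₂′
  Disjoint-⊆ S₁′⊆S₁ S₂′⊆S₂ S₁#S₂ x y xy₁ xy₂ = S₁#S₂ x y (S₁′⊆S₁ x y xy₁) (S₂′⊆S₂ x y xy₂)

  _≈ᵍ_ : Graph n → Graph n → Set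
  G ≈ᵍ H = ∀ x y → adj G x y ≡ adj H x y

  restrict : (G : Graph n) (Q : EdgeSet n) → (∀ x y → Q x y ≡ Q y x) → Graph n
  restrict G Q Q-sym = record
    { adj    = λ x y → adj G x y ∧ Q x y
    ; sym    = λ x y → cong₂ _∧_ (Graph.sym G x y) (Q-sym x y)
    ; irrefl = λ x → cong (_∧ Q x x) (irrefl G x)
    }

  relabel : Graph n → (Fin n → Fin n) → Graph n
  relabel G s = record
    { adj    = λ x y → adj G (s x) (s y)
    ; sym    = λ x y → Graph.sym G (s x) (s y)
    ; irrefl = λ x → irrefl G (s x)
    }

  isolate : Graph n → Fin n → Graph n
  isolate G w = restrict G (λ x y → not (x == w) ∧ not (y == w)) (λ x y → ∧-comm (not (x == w)) _)

  star : Graph n → Fin n → Graph n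
  star G w = restrict G (λ x y → (x == w) ∨ (y == w)) (λ x y → ∨-comm (x == w) _)

  avoiding : Graph n → Fin n → Fin n → Graph n
  avoiding G u v = isolate (isolate G u) v

  avoiding-comm : ∀ G u v → avoiding G u v ≈ᵍ avoiding G v u
  avoiding-comm G u v x y = begin
    (adj G x y ∧ Qu) ∧ Qv ≡⟨ ∧-assoc (adj G x y) Qu Qv ⟩
    adj G x y ∧ (Qu ∧ Qv) ≡⟨ cong (adj G x y ∧_) (∧-comm Qu Qv) ⟩
    adj G x y ∧ (Qv ∧ Qu) ≡⟨ ∧-assoc (adj G x y) Qv Qu ⟨
    (adj G x y ∧ Qv) ∧ Qu ∎
    where
    open ≡-Reasoning
    Qu Qv : Bool
    Qu = not (x == u) ∧ not (y == u)
    Qv = not (x == v) ∧ not (y == v)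

module _ {n : ℕ} (w x y : Fin n) where

  away-≢ : T (not (x == w) ∧ not (y == w)) → x ≢ w × y ≢ w
  away-≢ xy = let x-away , y-away = to T-∧ xy in to not-==⇔ x-away , to not-==⇔ y-away

  at-≡ : T ((x == w) ∨ (y == w)) → x ≡ w ⊎ y ≡ w
  at-≡ = Data.Sum.map ==⇒≡ ==⇒≡ ∘ to T-∨

module _ {n : ℕ} (G : Graph n) (w : Fin n) {x y : Fin n} where

  isolate-edge : T (adj G x y) → x ≢ w → y ≢ w → T (adj (isolate G w) x y)
  isolate-edge xy x≢w y≢w = from T-∧ (xy , from T-∧ (from not-==⇔ x≢w , from not-==⇔ y≢w))

  isolate-⊆ : T (adj (isolate G w) x y) → T (adj G x y)
  isolate-⊆ = proj₁ ∘ to T-∧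

  isolate-≢ : T (adj (isolate G w) x y) → x ≢ w × y ≢ w
  isolate-≢ = away-≢ w x y ∘ proj₂ ∘ to (T-∧ {adj G x y})

  star-edge : T (adj G x y) → x ≡ w ⊎ y ≡ w → T (adj (star G w) x y)
  star-edge xy at-w = from T-∧ (xy , from T-∨ (Data.Sum.map ≡⇒== ≡⇒== at-w))

  star-⊆ : T (adj (star G w) x y) → T (adj G x y)
  star-⊆ = proj₁ ∘ to T-∧

  star-≡ : T (adj (star G w) x y) → x ≡ w ⊎ y ≡ w
  star-≡ = at-≡ w x y ∘ proj₂ ∘ to (T-∧ {adj G x y})

module _ {n : ℕ} where

  module Regions (G : Graph n) {u v : Fin n} (u≢v : u ≢ v) (uv∉ : adj G u v ≡ false) where

    S₀ Sᵤ Sᵥ : EdgeSet n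
    S₀ = adj (avoiding G u v)
    Sᵤ = adj (star G u)
    Sᵥ = adj (star G v)

    S₀-vertices : ∀ {x y} → T (S₀ x y) → (x ≢ u × x ≢ v) × (y ≢ u × y ≢ v)
    S₀-vertices xy = let x≢u , y≢u = isolate-≢ G u (isolate-⊆ (isolate G u) v xy)
                         x≢v , y≢v = isolate-≢ (isolate G u) v xy
                     in (x≢u , x≢v) , (y≢u , y≢v)

    adj-split : ∀ x y → adj G x y ≡ (S₀ ∪ (Sᵤ ∪ Sᵥ)) x y
    adj-split x y = T-⇔⇒≡ edge-region region-edge
      where
      region-edge : T ((S₀ ∪ (Sᵤ ∪ Sᵥ)) x y) → T (adj G x y)
      region-edge xy with to (T-∨ {S₀ x y}) xy
      ... | inj₁ xy₀ = isolate-⊆ G u (isolate-⊆ (isolate G u) v xy₀)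
      ... | inj₂ xy₁₂ with to (T-∨ {Sᵤ x y}) xy₁₂
      ...   | inj₁ xyᵤ = star-⊆ G u xyᵤ
      ...   | inj₂ xyᵥ = star-⊆ G v xyᵥ
      edge-region : T (adj G x y) → T ((S₀ ∪ (Sᵤ ∪ Sᵥ)) x y)
      edge-region xy = by-cases (x ≟ u) (y ≟ u) (x ≟ v) (y ≟ v)
        where
        by-cases : Dec (x ≡ u) → Dec (y ≡ u) → Dec (x ≡ v) → Dec (y ≡ v) → T ((S₀ ∪ (Sᵤ ∪ Sᵥ)) x y)
        by-cases (yes x≡u) _ _ _ = ∪-⊆ʳ S₀ (Sᵤ ∪ Sᵥ) x y (∪-⊆ˡ Sᵤ Sᵥ x y (star-edge G u xy (inj₁ x≡u)))
        by-cases _ (yes y≡u) _ _ = ∪-⊆ʳ S₀ (Sᵤ ∪ Sᵥ) x y (∪-⊆ˡ Sᵤ Sᵥ x y (star-edge G u xy (inj₂ y≡u)))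
        by-cases _ _ (yes x≡v) _ = ∪-⊆ʳ S₀ (Sᵤ ∪ Sᵥ) x y (∪-⊆ʳ Sᵤ Sᵥ x y (star-edge G v xy (inj₁ x≡v)))
        by-cases _ _ _ (yes y≡v) = ∪-⊆ʳ S₀ (Sᵤ ∪ Sᵥ) x y (∪-⊆ʳ Sᵤ Sᵥ x y (star-edge G v xy (inj₂ y≡v)))
        by-cases (no x≢u) (no y≢u) (no x≢v) (no y≢v) =
          ∪-⊆ˡ S₀ (Sᵤ ∪ Sᵥ) x y (isolate-edge (isolate G u) v (isolate-edge G u xy x≢u y≢u) x≢v y≢v)

    S₀#Sᵤ : Disjoint S₀ Sᵤ
    S₀#Sᵤ x y xy₀ xyᵤ with S₀-vertices xy₀ | star-≡ G u xyᵤ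
    ... | (x≢u , _) , _ | inj₁ x≡u = x≢u x≡u
    ... | _ , (y≢u , _) | inj₂ y≡u = y≢u y≡u

    S₀#Sᵥ : Disjoint S₀ Sᵥ
    S₀#Sᵥ x y xy₀ xyᵥ with S₀-vertices xy₀ | star-≡ G v xyᵥ
    ... | (_ , x≢v) , _ | inj₁ x≡v = x≢v x≡v
    ... | _ , (_ , y≢v) | inj₂ y≡v = y≢v y≡v

    Sᵤ#Sᵥ : Disjoint Sᵤ Sᵥ
    Sᵤ#Sᵥ x y xyᵤ xyᵥ with star-≡ G u xyᵤ | star-≡ G v xyᵥ
    ... | inj₁ refl | inj₁ refl = u≢v refl
    ... | inj₂ refl | inj₂ refl = u≢v refl
    ... | inj₁ refl | inj₂ refl = subst T uv∉ (star-⊆ G u xyᵤ)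
    ... | inj₂ refl | inj₁ refl = subst T (trans (Graph.sym G v u) uv∉) (star-⊆ G u xyᵤ)

    isolate-v⊆ : adj (isolate G v) ⊆ (S₀ ∪ Sᵤ)
    isolate-v⊆ x y xy = by-cases (isolate-≢ G v xy) (x ≟ u) (y ≟ u)
      where
      by-cases : x ≢ v × y ≢ v → Dec (x ≡ u) → Dec (y ≡ u) → T ((S₀ ∪ Sᵤ) x y)
      by-cases _ (yes x≡u) _ = ∪-⊆ʳ S₀ Sᵤ x y (star-edge G u (isolate-⊆ G v xy) (inj₁ x≡u))
      by-cases _ _ (yes y≡u) = ∪-⊆ʳ S₀ Sᵤ x y (star-edge G u (isolate-⊆ G v xy) (inj₂ y≡u))
      by-cases (x≢v , y≢v) (no x≢u) (no y≢u) =
        ∪-⊆ˡ S₀ Sᵤ x y (isolate-edge (isolate G u) v (isolate-edge G u (isolate-⊆ G v xy) x≢u y≢u) x≢v y≢v)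

    isolate-u⊆ : adj (isolate G u) ⊆ (S₀ ∪ Sᵥ)
    isolate-u⊆ x y xy = by-cases (isolate-≢ G u xy) (x ≟ v) (y ≟ v)
      where
      by-cases : x ≢ u × y ≢ u → Dec (x ≡ v) → Dec (y ≡ v) → T ((S₀ ∪ Sᵥ) x y)
      by-cases _ (yes x≡v) _ = ∪-⊆ʳ S₀ Sᵥ x y (star-edge G v (isolate-⊆ G u xy) (inj₁ x≡v))
      by-cases _ _ (yes y≡v) = ∪-⊆ʳ S₀ Sᵥ x y (star-edge G v (isolate-⊆ G u xy) (inj₂ y≡v))
      by-cases _ (no x≢v) (no y≢v) = ∪-⊆ˡ S₀ Sᵥ x y (isolate-edge (isolate G u) v xy x≢v y≢v)

module _ {n : ℕ} where

  replace : Fin n → Fin n → Fin n → Fin n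
  replace v u x = if x == v then u else x

  clone : Graph n → Fin n → Fin n → Graph n
  clone G u v = relabel G (replace v u)

  replace-≢ : ∀ {v u x} → x ≢ v → replace v u x ≡ x
  replace-≢ {v} {u} {x} x≢v rewrite ⌊⌋-no (x ≟ v) x≢v = refl

  replace-≡ : ∀ {v u} → replace v u v ≡ u
  replace-≡ {v} rewrite ⌊⌋-yes (v ≟ v) refl = refl

  module Swap {u v : Fin n} (u≢v : u ≢ v) where

    τ σ : Fin n → Fin n
    τ = transpose u v
    σ = replace v u

    σ-fix : ∀ {x} → x ≢ v → σ x ≡ x
    σ-fix = replace-≢

    σ-v : σ v ≡ u
    σ-v = replace-≡ {v}

    τ-fix : ∀ {x} → x ≢ u → x ≢ v → τ x ≡ x
    τ-fix {x} x≢u x≢v rewrite dec-false (x ≟ u) x≢u | dec-false (x ≟ v) x≢v = refl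

    τ-u : τ u ≡ v
    τ-u rewrite dec-true (u ≟ u) refl = refl

    τ-v : τ v ≡ u
    τ-v rewrite dec-false (v ≟ u) (u≢v ∘ sym) | dec-true (v ≟ v) refl = refl

    τ-involutive : ∀ x → τ (τ x) ≡ x
    τ-involutive x = by-cases (x ≟ u) (x ≟ v)
      where
      by-cases : Dec (x ≡ u) → Dec (x ≡ v) → τ (τ x) ≡ x
      by-cases (yes refl) _ = trans (cong τ τ-u) τ-v
      by-cases _ (yes refl) = trans (cong τ τ-v) τ-u
      by-cases (no x≢u) (no x≢v) = trans (cong τ (τ-fix x≢u x≢v)) (τ-fix x≢u x≢v)

    τ-==-v : ∀ x → (τ x == v) ≡ (x == u)
    τ-==-v x = trans (cong (τ x ==_) (sym τ-u)) (==-injective (involutive⇒injective {τ = τ} τ-involutive) x u)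

    τ-==-u : ∀ x → (τ x == u) ≡ (x == v)
    τ-==-u x = trans (cong (τ x ==_) (sym τ-v)) (==-injective (involutive⇒injective {τ = τ} τ-involutive) x v)

    σ≡τ : ∀ {x} → x ≢ u → σ x ≡ τ x
    σ≡τ {x} x≢u = by-cases (x ≟ v)
      where
      by-cases : Dec (x ≡ v) → σ x ≡ τ x
      by-cases (yes refl) = trans σ-v (sym τ-v)
      by-cases (no x≢v)   = trans (σ-fix x≢v) (sym (τ-fix x≢u x≢v))

  module Clone (G : Graph n) {u v : Fin n} (u≢v : u ≢ v) (uv∉ : adj G u v ≡ false) where
    open Swap u≢v

    H : Graph n
    H = clone G u v

    H-uv∉ : adj H u v ≡ false
    H-uv∉ = trans (cong₂ (adj G) (σ-fix u≢v) σ-v) (irrefl G u)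

    adj-u-σ : ∀ y → adj G u (σ y) ≡ adj G u y
    adj-u-σ y = by-cases (y ≟ v)
      where
      by-cases : Dec (y ≡ v) → adj G u (σ y) ≡ adj G u y
      by-cases (yes refl) = trans (cong (adj G u) σ-v) (trans (irrefl G u) (sym uv∉))
      by-cases (no y≢v)   = cong (adj G u) (σ-fix y≢v)

    adj-u-στ : ∀ y → adj G u (σ y) ≡ adj G u (τ y)
    adj-u-στ y = by-cases (y ≟ u)
      where
      by-cases : Dec (y ≡ u) → adj G u (σ y) ≡ adj G u (τ y)
      by-cases (yes refl) = trans (adj-u-σ u) (trans (irrefl G u) (trans (sym uv∉) (cong (adj G u) (sym τ-u))))
      by-cases (no y≢u)   = cong (adj G u) (σ≡τ y≢u)

    isolate-v : isolate H v ≈ᵍ isolate G v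
    isolate-v x y = ∧-guard (not (x == v) ∧ not (y == v)) λ away →
      let x≢v , y≢v = away-≢ v x y away in cong₂ (adj G) (σ-fix x≢v) (σ-fix y≢v)

    isolate-u : isolate H u ≈ᵍ relabel (isolate G v) τ
    isolate-u x y = trans
      (∧-guard (not (x == u) ∧ not (y == u)) λ away →
        let x≢u , y≢u = away-≢ u x y away in cong₂ (adj G) (σ≡τ x≢u) (σ≡τ y≢u))
      (cong (adj G (τ x) (τ y) ∧_) (cong₂ (λ a b → not a ∧ not b) (sym (τ-==-v x)) (sym (τ-==-v y))))

    avoiding-uv : avoiding H u v ≈ᵍ avoiding G u v
    avoiding-uv x y = ∧-guard (not (x == v) ∧ not (y == v)) λ away →
      let x≢v , y≢v = away-≢ v x y away in
      cong (_∧ (not (x == u) ∧ not (y == u))) (cong₂ (adj G) (σ-fix x≢v) (σ-fix y≢v))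

    star-u : star H u ≈ᵍ star G u
    star-u x y = ∧-guard ((x == u) ∨ (y == u)) λ at → by-cases (at-≡ u x y at)
      where
      by-cases : x ≡ u ⊎ y ≡ u → adj G (σ x) (σ y) ≡ adj G x y
      by-cases (inj₁ refl) = trans (cong (λ z → adj G z (σ y)) (σ-fix u≢v)) (adj-u-σ y)
      by-cases (inj₂ refl) = trans (cong (adj G (σ x)) (σ-fix u≢v))
        (trans (Graph.sym G (σ x) u) (trans (adj-u-σ x) (Graph.sym G u x)))

    star-v : star H v ≈ᵍ relabel (star G u) τ
    star-v x y = trans
      (∧-guard ((x == v) ∨ (y == v)) λ at → by-cases (at-≡ v x y at))
      (cong (adj G (τ x) (τ y) ∧_) (cong₂ _∨_ (sym (τ-==-u x)) (sym (τ-==-u y))))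
      where
      by-cases : x ≡ v ⊎ y ≡ v → adj G (σ x) (σ y) ≡ adj G (τ x) (τ y)
      by-cases (inj₁ refl) = trans (cong (λ z → adj G z (σ y)) σ-v)
        (trans (adj-u-στ y) (cong (λ z → adj G z (τ y)) (sym τ-v)))
      by-cases (inj₂ refl) = trans (cong (adj G (σ x)) σ-v)
        (trans (Graph.sym G (σ x) u) (trans (adj-u-στ x)
          (trans (Graph.sym G u (τ x)) (cong (adj G (τ x)) (sym τ-v)))))

module _ {n : ℕ} where

  pairs≡cartesianProduct : pairs n ≡ cartesianProduct (allFin n) (allFin n)
  pairs≡cartesianProduct = concatMap-map≡cartesianProductWith _,_ (allFin n) (allFin n)

  module _ (G : Graph n) where

    edgeList-unique : Unique≡ (edgeList G)
    edgeList-unique = Uniqueₚ.filter⁺ _ (subst Unique≡ (sym pairs≡cartesianProduct)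
      (Uniqueₚ.cartesianProduct⁺ (Uniqueₚ.allFin⁺ n) (Uniqueₚ.allFin⁺ n)))

    ∈-edgeList : ∀ {x y} → x < y → T (adj G x y) → (x , y) ∈ edgeList G
    ∈-edgeList x<y xy = ∈-filter⁺ _
      (subst (_ ∈_) (sym pairs≡cartesianProduct) (∈-cartesianProduct⁺ (∈-allFin _) (∈-allFin _)))
      (from T-∧ (fromWitness x<y , xy))

    ends-edge : ∀ p → T (⌊ proj₁ (ends G p) <? proj₂ (ends G p) ⌋ ∧ adj G (proj₁ (ends G p)) (proj₂ (ends G p)))
    ends-edge p = proj₂ (∈-filter⁻ _ {xs = pairs n} (∈-lookup p))

    ends-< : ∀ p → proj₁ (ends G p) < proj₂ (ends G p)
    ends-< p = toWitness (proj₁ (to (T-∧ {⌊ proj₁ (ends G p) <? proj₂ (ends G p) ⌋}) (ends-edge p)))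

    ends-adj : ∀ p → T (adj G (proj₁ (ends G p)) (proj₂ (ends G p)))
    ends-adj p = proj₂ (to (T-∧ {⌊ proj₁ (ends G p) <? proj₂ (ends G p) ⌋}) (ends-edge p))

    ends-≢ : ∀ p → proj₁ (ends G p) ≢ proj₂ (ends G p)
    ends-≢ p eq = Fin.<-irrefl eq (ends-< p)

    edgeIndex : ∀ {x y} → x < y → T (adj G x y) → Σ (Fin (e G)) λ p → ends G p ≡ (x , y)
    edgeIndex {x} {y} x<y xy = index xy∈ , sym (lookup-index xy∈)
      where
      xy∈ : (x , y) ∈ edgeList G
      xy∈ = ∈-edgeList x<y xy

    index-ends : ∀ p (m : ends G p ∈ edgeList G) → index m ≡ p
    index-ends p m = Unique⇒lookup-injective (≡.setoid _) edgeList-unique (index m) p (sym (lookup-index m))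

-- Colourings of vertex pairs

-- Edge colourings of the various graphs on Fin n are compared as colourings of vertex pairs, read
-- on unordered pairs through `colour`.
PairColouring : ℕ → ℕ → Set
PairColouring n r = Fin n → Fin n → Fin r

module _ {n r : ℕ} where

  colour : PairColouring n r → Fin n → Fin n → Fin r
  colour C x y = if ⌊ x <? y ⌋ then C x y else C y x

  colour-< : ∀ C {x y} → x < y → colour C x y ≡ C x y
  colour-< C {x} {y} x<y rewrite ⌊⌋-yes (x <? y) x<y = refl

  colour-sym : ∀ C x y → colour C x y ≡ colour C y x
  colour-sym C x y with Fin.<-cmp x y
  ... | tri< x<y _ y≮x rewrite ⌊⌋-yes (x <? y) x<y | ⌊⌋-no (y <? x) y≮x = refl
  ... | tri≈ _ refl _  = refl
  ... | tri> x≮y _ y<x rewrite ⌊⌋-no (x <? y) x≮y | ⌊⌋-yes (y <? x) y<x = refl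

  _∘ᶜ_ : PairColouring n r → (Fin n → Fin n) → PairColouring n r
  (C ∘ᶜ τ) x y = colour C (τ x) (τ y)

  colour-∘ᶜ : ∀ C τ x y → colour (C ∘ᶜ τ) x y ≡ colour C (τ x) (τ y)
  colour-∘ᶜ C τ x y with ⌊ x <? y ⌋
  ... | true  = refl
  ... | false = colour-sym C (τ y) (τ x)

  _≈[_]_ : PairColouring n r → EdgeSet n → PairColouring n r → Set
  C ≈[ S ] D = ∀ x y → T (S x y) → colour C x y ≡ colour D x y

  ≈-setoid : EdgeSet n → Setoid 0ℓ 0ℓ
  ≈-setoid S = record
    { Carrier       = PairColouring n r
    ; _≈_           = λ C D → C ≈[ S ] D
    ; isEquivalence = record
      { refl  = λ x y _ → refl
      ; sym   = λ C≈D x y xy → sym (C≈D x y xy)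
      ; trans = λ C≈D D≈E x y xy → trans (C≈D x y xy) (D≈E x y xy)
      }
    }

  ≈-mono : ∀ {S S′ : EdgeSet n} {C D} → S′ ⊆ S → C ≈[ S ] D → C ≈[ S′ ] D
  ≈-mono S′⊆S C≈D x y xy = C≈D x y (S′⊆S x y xy)

  IsExactEnumeration-≈-cong : ∀ {S S′ : EdgeSet n} {L} → (∀ x y → S x y ≡ S′ x y) →
    IsExactEnumeration (≈-setoid S) L → IsExactEnumeration (≈-setoid S′) L
  IsExactEnumeration-≈-cong S≡S′ L-exact = record
    { unique     = AllPairs.map (λ C≉D C≈D → C≉D (≈-mono (λ x y → subst T (S≡S′ x y)) C≈D)) unique
    ; enumerates = λ C → Any.map (≈-mono (λ x y → subst T (sym (S≡S′ x y)))) (enumerates C)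
    }
    where open IsExactEnumeration L-exact

  ≈-on-< : ∀ (G : Graph n) C D → (∀ x y → x < y → T (adj G x y) → C x y ≡ D x y) → C ≈[ adj G ] D
  ≈-on-< G C D agree x y xy with Fin.<-cmp x y
  ... | tri< x<y _ _ = trans (colour-< C x<y) (trans (agree x y x<y xy) (sym (colour-< D x<y)))
  ... | tri≈ _ refl _ = ⊥-elim (subst T (irrefl G x) xy)
  ... | tri> _ _ y<x =
    trans (colour-sym C x y) (trans (colour-< C y<x)
      (trans (agree y x y<x (subst T (Graph.sym G x y) xy)) (trans (sym (colour-< D y<x)) (colour-sym D y x))))

module _ {n r : ℕ} where

  glue : EdgeSet n → PairColouring n r → PairColouring n r → PairColouring n r
  glue S C D x y = if S x y then colour C x y else colour D x y

  colour-symmetric : ∀ (M : PairColouring n r) → (∀ x y → M x y ≡ M y x) → ∀ x y → colour M x y ≡ M x y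
  colour-symmetric M M-sym x y with ⌊ x <? y ⌋
  ... | true  = refl
  ... | false = M-sym y x

  colour-glue : ∀ {S} → Symmetric S → ∀ C D x y → colour (glue S C D) x y ≡ glue S C D x y
  colour-glue {S} S-sym C D = colour-symmetric (glue S C D) glue-sym
    where
    glue-sym : ∀ x y → glue S C D x y ≡ glue S C D y x
    glue-sym x y rewrite S-sym x y | colour-sym C x y | colour-sym D x y = refl

  colour-glue-in : ∀ {S} → Symmetric S → ∀ C D {x y} → T (S x y) → colour (glue S C D) x y ≡ colour C x y
  colour-glue-in {S} S-sym C D {x} {y} xy with S x y | colour-glue S-sym C D x y
  ... | true | eq = eq

  colour-glue-out : ∀ {S} → Symmetric S → ∀ C D {x y} → ¬ T (S x y) → colour (glue S C D) x y ≡ colour D x y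
  colour-glue-out {S} S-sym C D {x} {y} xy∉ with S x y | colour-glue S-sym C D x y
  ... | true  | _  = ⊥-elim (xy∉ _)
  ... | false | eq = eq

  colour-glue-self : ∀ {S} → Symmetric S → ∀ C x y → colour (glue S C C) x y ≡ colour C x y
  colour-glue-self {S} S-sym C x y with S x y | colour-glue S-sym C C x y
  ... | true  | eq = eq
  ... | false | eq = eq

  module _ {S₁ S₂ : EdgeSet n} (S₁-sym : Symmetric S₁) (S₁#S₂ : Disjoint S₁ S₂) where

    colour-glue-right : ∀ C D {x y} → T (S₂ x y) → colour (glue S₁ C D) x y ≡ colour D x y
    colour-glue-right C D {x} {y} xy = colour-glue-out S₁-sym C D (λ xy₁ → S₁#S₂ x y xy₁ xy)

    glue-≈ : ∀ {C C′ D D′} → C ≈[ S₁ ] C′ → D ≈[ S₂ ] D′ → glue S₁ C D ≈[ S₁ ∪ S₂ ] glue S₁ C′ D′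
    glue-≈ {C} {C′} {D} {D′} C≈C′ D≈D′ x y xy with to (T-∨ {S₁ x y}) xy
    ... | inj₁ xy₁ = trans (colour-glue-in S₁-sym C D xy₁)
                       (trans (C≈C′ x y xy₁) (sym (colour-glue-in S₁-sym C′ D′ xy₁)))
    ... | inj₂ xy₂ = trans (colour-glue-right C D xy₂)
                       (trans (D≈D′ x y xy₂) (sym (colour-glue-right C′ D′ xy₂)))

    glue-≈⁻ : ∀ {C C′ D D′} → glue S₁ C D ≈[ S₁ ∪ S₂ ] glue S₁ C′ D′ → C ≈[ S₁ ] C′ × D ≈[ S₂ ] D′
    glue-≈⁻ {C} {C′} {D} {D′} glue≈ =
      (λ x y xy₁ → trans (sym (colour-glue-in S₁-sym C D xy₁))
                     (trans (glue≈ x y (∪-⊆ˡ S₁ S₂ x y xy₁)) (colour-glue-in S₁-sym C′ D′ xy₁))) ,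
      (λ x y xy₂ → trans (sym (colour-glue-right C D xy₂))
                     (trans (glue≈ x y (∪-⊆ʳ S₁ S₂ x y xy₂)) (colour-glue-right C′ D′ xy₂)))

    glue-exact : ∀ {L₁ L₂} → IsExactEnumeration (≈-setoid S₁) L₁ → IsExactEnumeration (≈-setoid S₂) L₂ →
      IsExactEnumeration (≈-setoid (S₁ ∪ S₂)) (cartesianProductWith (glue S₁) L₁ L₂)
    glue-exact L₁-exact L₂-exact = record
      { unique     = SetoidUniqueₚ.cartesianProductWith⁺ (≈-setoid S₁) (≈-setoid S₂) (≈-setoid (S₁ ∪ S₂))
                       (glue S₁) glue-≈⁻ (unique L₁-exact) (unique L₂-exact)
      ; enumerates = λ C → SetoidMembershipₚ.∈-resp-≈ (≈-setoid (S₁ ∪ S₂))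
                       (λ x y _ → colour-glue-self S₁-sym C x y)
                       (SetoidMembershipₚ.∈-cartesianProductWith⁺ (≈-setoid S₁) (≈-setoid S₂)
                         (≈-setoid (S₁ ∪ S₂)) glue-≈ (enumerates L₁-exact C) (enumerates L₂-exact C))
      }
      where open IsExactEnumeration

  glue-∘ᶜ : ∀ {S} → Symmetric S → ∀ {τ : Fin n → Fin n} → (∀ x → τ (τ x) ≡ x) →
    (∀ x y → T (S x y) → τ x ≡ x × τ y ≡ y) →
    ∀ χ α x y → colour (glue S χ (α ∘ᶜ τ) ∘ᶜ τ) x y ≡ colour (glue S χ α) x y
  glue-∘ᶜ {S} S-sym {τ} τ-involutive τ-fixes χ α x y = begin
    colour (glue S χ (α ∘ᶜ τ) ∘ᶜ τ) x y
      ≡⟨ colour-∘ᶜ (glue S χ (α ∘ᶜ τ)) τ x y ⟩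
    colour (glue S χ (α ∘ᶜ τ)) (τ x) (τ y)
      ≡⟨ colour-glue S-sym χ (α ∘ᶜ τ) (τ x) (τ y) ⟩
    (if S (τ x) (τ y) then colour χ (τ x) (τ y) else colour (α ∘ᶜ τ) (τ x) (τ y))
      ≡⟨ cong (if_then colour χ (τ x) (τ y) else colour (α ∘ᶜ τ) (τ x) (τ y)) S-τ ⟩
    (if S x y then colour χ (τ x) (τ y) else colour (α ∘ᶜ τ) (τ x) (τ y))
      ≡⟨ branches (S x y) refl ⟩
    (if S x y then colour χ x y else colour α x y)
      ≡⟨ colour-glue S-sym χ α x y ⟨
    colour (glue S χ α) x y ∎
    where
    open ≡-Reasoning
    S-τ : S (τ x) (τ y) ≡ S x y
    S-τ = T-⇔⇒≡
      (λ xy → let ττx , ττy = τ-fixes (τ x) (τ y) xy in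
        subst₂ (λ x′ y′ → T (S x′ y′)) (trans (sym ττx) (τ-involutive x)) (trans (sym ττy) (τ-involutive y)) xy)
      (λ xy → let τx , τy = τ-fixes x y xy in subst₂ (λ x′ y′ → T (S x′ y′)) (sym τx) (sym τy) xy)
    branches : ∀ b → S x y ≡ b →
      (if b then colour χ (τ x) (τ y) else colour (α ∘ᶜ τ) (τ x) (τ y)) ≡ (if b then colour χ x y else colour α x y)
    branches true  xy = let τx , τy = τ-fixes x y (subst T (sym xy) _) in cong₂ (colour χ) τx τy
    branches false _  = trans (colour-∘ᶜ α τ (τ x) (τ y)) (cong₂ (colour α) (τ-involutive x) (τ-involutive y))

  relabel-exact : ∀ {S : EdgeSet n} {L : List (PairColouring n r)} (τ : Fin n → Fin n) → (∀ x → τ (τ x) ≡ x) →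
    IsExactEnumeration (≈-setoid S) L →
    IsExactEnumeration (≈-setoid (λ x y → S (τ x) (τ y))) (map (_∘ᶜ τ) L)
  relabel-exact {S} τ τ-involutive L-exact = record
    { unique     = SetoidUniqueₚ.map⁺ (≈-setoid S) (≈-setoid (λ x y → S (τ x) (τ y))) reflects (unique L-exact)
    ; enumerates = λ C → Anyₚ.map⁺ (Any.map (λ {D} C∘τ≈D x y xy →
                     trans (sym (colour-ττ C x y)) (trans (C∘τ≈D (τ x) (τ y) xy) (sym (colour-∘ᶜ D τ x y))))
                     (enumerates L-exact (C ∘ᶜ τ)))
    }
    where
    open IsExactEnumeration
    colour-ττ : ∀ C x y → colour (C ∘ᶜ τ) (τ x) (τ y) ≡ colour C x y
    colour-ττ C x y = trans (colour-∘ᶜ C τ (τ x) (τ y)) (cong₂ (colour C) (τ-involutive x) (τ-involutive y))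
    reflects : ∀ {C D} → (C ∘ᶜ τ) ≈[ (λ x y → S (τ x) (τ y)) ] (D ∘ᶜ τ) → C ≈[ S ] D
    reflects {C} {D} C∘τ≈D∘τ x y xy = begin
      colour C x y                ≡⟨ colour-ττ C x y ⟨
      colour (C ∘ᶜ τ) (τ x) (τ y) ≡⟨ C∘τ≈D∘τ (τ x) (τ y) (subst T (sym (cong₂ S (τ-involutive x) (τ-involutive y))) xy) ⟩
      colour (D ∘ᶜ τ) (τ x) (τ y) ≡⟨ colour-ττ D x y ⟩
      colour D x y                ∎
      where open ≡-Reasoning

  module _ {S S₀ S₁ S₂ : EdgeSet n} (S₀-sym : Symmetric S₀) (S₁-sym : Symmetric S₁)
           (S₀#S₁ : Disjoint S₀ S₁) (S₀#S₂ : Disjoint S₀ S₂) (S₁#S₂ : Disjoint S₁ S₂)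
           (S-split : ∀ x y → S x y ≡ (S₀ ∪ (S₁ ∪ S₂)) x y)
           {L L₀ L₁ L₂ : List (PairColouring n r)}
           (L-exact  : IsExactEnumeration (≈-setoid S) L)   (L₀-exact : IsExactEnumeration (≈-setoid S₀) L₀)
           (L₁-exact : IsExactEnumeration (≈-setoid S₁) L₁) (L₂-exact : IsExactEnumeration (≈-setoid S₂) L₂)
           (A B : PairColouring n r → Bool)
           (A-cong : Congruent _≈[ S₀ ∪ S₁ ]_ _≡_ A) (B-cong : Congruent _≈[ S₀ ∪ S₂ ]_ _≡_ B) where

    -- A colouring of S₀ ∪ S₁ ∪ S₂ is a triple (χ , α , β); A only sees (χ , α) and B only (χ , β).
    count-∧-split : count (λ C → A C ∧ B C) L ≡
      sum (map (λ χ → count (A ∘ glue S₀ χ) L₁ * count (B ∘ glue S₀ χ) L₂) L₀)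
    count-∧-split = begin
      count P L
        ≡⟨ count-invariant (≈-setoid S) P P-cong L-exact glued-exact ⟩
      count P (cartesianProductWith (glue S₀) L₀ (cartesianProductWith (glue S₁) L₁ L₂))
        ≡⟨ count-cartesianProductWith P (glue S₀) L₀ _ ⟩
      sum (map (λ χ → count (P ∘ glue S₀ χ) (cartesianProductWith (glue S₁) L₁ L₂)) L₀)
        ≡⟨ cong sum (map-cong (λ χ → count-cartesianProductWith-∧ (P ∘ glue S₀ χ) (A ∘ glue S₀ χ)
                                        (B ∘ glue S₀ χ) (glue S₁) L₁ L₂ (factor χ)) L₀) ⟩
      sum (map (λ χ → count (A ∘ glue S₀ χ) L₁ * count (B ∘ glue S₀ χ) L₂) L₀) ∎
      where
      open ≡-Reasoning
      P : PairColouring n r → Bool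
      P C = A C ∧ B C
      S₀#S₁₂ : Disjoint S₀ (S₁ ∪ S₂)
      S₀#S₁₂ x y xy₀ xy₁₂ with to (T-∨ {S₁ x y}) xy₁₂
      ... | inj₁ xy₁ = S₀#S₁ x y xy₀ xy₁
      ... | inj₂ xy₂ = S₀#S₂ x y xy₀ xy₂
      glued-exact : IsExactEnumeration (≈-setoid S)
                      (cartesianProductWith (glue S₀) L₀ (cartesianProductWith (glue S₁) L₁ L₂))
      glued-exact = IsExactEnumeration-≈-cong (λ x y → sym (S-split x y))
        (glue-exact S₀-sym S₀#S₁₂ L₀-exact (glue-exact S₁-sym S₁#S₂ L₁-exact L₂-exact))
      ⊆S : ∀ {S′} → S′ ⊆ (S₀ ∪ (S₁ ∪ S₂)) → S′ ⊆ S
      ⊆S S′⊆ x y xy = subst T (sym (S-split x y)) (S′⊆ x y xy)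
      P-cong : ∀ {C D} → C ≈[ S ] D → P C ≡ P D
      P-cong C≈D = cong₂ _∧_ (A-cong (≈-mono (⊆S (∪-mono (λ _ _ xy → xy) (∪-⊆ˡ S₁ S₂))) C≈D))
                             (B-cong (≈-mono (⊆S (∪-mono (λ _ _ xy → xy) (∪-⊆ʳ S₁ S₂))) C≈D))
      factor : ∀ χ α β → P (glue S₀ χ (glue S₁ α β)) ≡ A (glue S₀ χ α) ∧ B (glue S₀ χ β)
      factor χ α β = cong₂ _∧_
        (A-cong (glue-≈ S₀-sym S₀#S₁ (λ _ _ _ → refl) (λ x y → colour-glue-in S₁-sym α β)))
        (B-cong (glue-≈ S₀-sym S₀#S₂ (λ _ _ _ → refl) (λ x y → colour-glue-right S₁-sym S₁#S₂ α β)))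

module _ {n r : ℕ} (G : Graph n) where
  open DecMembership (≡-dec (Fin._≟_ {n}) (λ {_} → Fin._≟_ {n})) using (_∈?_)

  edgeColouring : PairColouring n (suc r) → Coloring (suc r) G
  edgeColouring C p = C (proj₁ (ends G p)) (proj₂ (ends G p))

  -- Non-edges get the junk colour zero; they are never read.
  readEdge : Coloring (suc r) G → Fin n × Fin n → Fin (suc r)
  readEdge c xy with xy ∈? edgeList G
  ... | yes xy∈ = c (index xy∈)
  ... | no _    = zero

  pairColouring : Coloring (suc r) G → PairColouring n (suc r)
  pairColouring c x y = readEdge c (x , y)

  readEdge-ends : ∀ c p → readEdge c (ends G p) ≡ c p
  readEdge-ends c p with ends G p ∈? edgeList G
  ... | yes p∈ = cong c (index-ends G p p∈)
  ... | no  p∉ = ⊥-elim (p∉ (∈-lookup p))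

  pairColouring-≈ : ∀ c C → (∀ p → c p ≡ edgeColouring C p) → pairColouring c ≈[ adj G ] C
  pairColouring-≈ c C c≗C = ≈-on-< G (pairColouring c) C agree
    where
    agree : ∀ x y → x < y → T (adj G x y) → pairColouring c x y ≡ C x y
    agree x y x<y xy with edgeIndex G x<y xy
    ... | p , refl = trans (readEdge-ends c p) (c≗C p)

  pairColouring-injective : ∀ {c d} → pairColouring c ≈[ adj G ] pairColouring d → c ≗ d
  pairColouring-injective {c} {d} c≈d p = begin
    c p                                    ≡⟨ readEdge-ends c p ⟨
    pairColouring c x y                    ≡⟨ colour-< (pairColouring c) (ends-< G p) ⟨
    colour (pairColouring c) x y           ≡⟨ c≈d x y (ends-adj G p) ⟩
    colour (pairColouring d) x y           ≡⟨ colour-< (pairColouring d) (ends-< G p) ⟩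
    pairColouring d x y                    ≡⟨ readEdge-ends d p ⟩
    d p                                    ∎
    where
    open ≡-Reasoning
    x y : Fin n
    x = proj₁ (ends G p)
    y = proj₂ (ends G p)

  colourings : List (PairColouring n (suc r))
  colourings = map pairColouring (allFuns (e G) (allFin (suc r)))

  colourings-exact : IsExactEnumeration (≈-setoid (adj G)) colourings
  colourings-exact = record
    { unique     = SetoidUniqueₚ.map⁺ (Fin (e G) →-setoid Fin (suc r)) (≈-setoid (adj G))
                     pairColouring-injective (allFuns-unique (e G) (Uniqueₚ.allFin⁺ (suc r)))
    ; enumerates = λ C → Anyₚ.map⁺ (Any.map
                     (λ {c} C≗c → λ x y xy → sym (pairColouring-≈ c C (λ p → sym (C≗c p)) x y xy))
                     (allFuns⁺ (λ a b → b ≡ a) (e G) (allFin (suc r)) (edgeColouring C) (λ p → ∈-allFin _)))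
    }

module _ {n : ℕ} where

  graphOf : (Fin n → Fin n → Bool) → Graph n
  graphOf f = record
    { adj    = λ x y → upper x y ∨ upper y x
    ; sym    = λ x y → ∨-comm (upper x y) (upper y x)
    ; irrefl = λ x → cong (λ b → b ∨ b) (cong (_∧ f x x) (⌊⌋-no (x <? x) (Fin.<-irrefl refl)))
    }
    where
    upper : Fin n → Fin n → Bool
    upper x y = ⌊ x <? y ⌋ ∧ f x y

  graphOf-≈ᵍ : ∀ {f} (H : Graph n) → (∀ x y → f x y ≡ adj H x y) → graphOf f ≈ᵍ H
  graphOf-≈ᵍ {f} H f≡H x y with Fin.<-cmp x y
  ... | tri< x<y _ y≮x rewrite ⌊⌋-yes (x <? y) x<y | ⌊⌋-no (y <? x) y≮x = trans (∨-identityʳ (f x y)) (f≡H x y)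
  ... | tri≈ _ refl _  rewrite ⌊⌋-no (x <? x) (Fin.<-irrefl refl) = sym (irrefl H x)
  ... | tri> x≮y _ y<x rewrite ⌊⌋-no (x <? y) x≮y | ⌊⌋-yes (y <? x) y<x = trans (f≡H y x) (Graph.sym H y x)

  graphs : List (Graph n)
  graphs = map graphOf (allFuns n (allFuns n (true ∷ false ∷ [])))

  graphs-complete : ∀ H → Σ (Graph n) λ G → G ∈ graphs × G ≈ᵍ H
  graphs-complete H =
    let f , f∈ , f≡H = find (allFuns⁺ (λ row h → ∀ y → row y ≡ h y) n _ (adj H) λ x →
                               allFuns⁺ _≡_ n _ (adj H x) (λ y → boolean (adj H x y)))
    in graphOf f , ∈-map⁺ graphOf f∈ , graphOf-≈ᵍ H f≡H
    where
    boolean : ∀ b → Any (_≡ b) (true ∷ false ∷ [])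
    boolean true  = here refl
    boolean false = there (here refl)

-- Counting F̂-free colourings

module _ {n r k : ℕ} (F : Coloring (suc r) (K k)) where

  imageColour : PairColouring n (suc r) → (Fin k → Fin n) → Fin (e (K k)) → Fin (suc r)
  imageColour C φ p = colour C (φ (proj₁ (ends (K k) p))) (φ (proj₂ (ends (K k) p)))

  record Embeds (G : Graph n) (C : PairColouring n (suc r)) : Set where
    field
      φ         : Fin k → Fin n
      injective : ∀ a b → φ a ≡ φ b → a ≡ b
      clique    : ∀ a b → a ≢ b → T (adj G (φ a) (φ b))
      matches   : ∀ p q → (F p == F q) ≡ (imageColour C φ p == imageColour C φ q)

  Embeds-resp-≈ : ∀ {G C D} → C ≈[ adj G ] D → Embeds G C → Embeds G D
  Embeds-resp-≈ {G} {C} {D} C≈D E = record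
    { φ = φ ; injective = injective ; clique = clique
    ; matches = λ p q → trans (matches p q) (cong₂ _==_ (same p) (same q))
    }
    where
    open Embeds E
    same : ∀ p → imageColour C φ p ≡ imageColour D φ p
    same p = C≈D _ _ (clique _ _ (ends-≢ (K k) p))

  reindex : ∀ {G C} (E : Embeds G C) ψ → Embeds.φ E ≗ ψ → Embeds G C
  reindex {G} {C} E ψ φ≗ψ = record
    { φ         = ψ
    ; injective = λ a b eq → injective a b (trans (φ≗ψ a) (trans eq (sym (φ≗ψ b))))
    ; clique    = λ a b a≢b → subst₂ (λ x y → T (adj G x y)) (φ≗ψ a) (φ≗ψ b) (clique a b a≢b)
    ; matches   = λ p q → trans (matches p q) (cong₂ _==_ (same p) (same q))
    }
    where
    open Embeds E
    same : ∀ p → imageColour C φ p ≡ imageColour C ψ p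
    same p = cong₂ (colour C) (φ≗ψ _) (φ≗ψ _)

  Embeds-mono : ∀ {G H C} → adj G ⊆ adj H → Embeds G C → Embeds H C
  Embeds-mono G⊆H E = record
    { φ = φ ; injective = injective ; clique = λ a b a≢b → G⊆H _ _ (clique a b a≢b) ; matches = matches }
    where open Embeds E

  -- A clique cannot contain both of the non-adjacent vertices u and v.
  Embeds-split : ∀ {G C u v} → u ≢ v → adj G u v ≡ false →
    Embeds G C → Embeds (isolate G v) C ⊎ Embeds (isolate G u) C
  Embeds-split {G} {C} {u} {v} u≢v uv∉ E with Fin.any? (λ a → Embeds.φ E a ≟ v)
  ... | no v∉φ = inj₁ (record { φ = φ ; injective = injective ; matches = matches
    ; clique = λ a b a≢b → isolate-edge G v (clique a b a≢b) (λ eq → v∉φ (a , eq)) (λ eq → v∉φ (b , eq)) })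
    where open Embeds E
  ... | yes (a , φa≡v) = inj₂ (record { φ = φ ; injective = injective ; matches = matches
    ; clique = λ b c b≢c → isolate-edge G u (clique b c b≢c) (avoids-u b) (avoids-u c) })
    where
    open Embeds E
    avoids-u : ∀ b → φ b ≢ u
    avoids-u b φb≡u = subst T (trans (cong₂ (adj G) φb≡u φa≡v) uv∉) (clique b a b≢a)
      where
      b≢a : b ≢ a
      b≢a b≡a = u≢v (trans (sym φb≡u) (trans (cong φ b≡a) φa≡v))

  module _ (τ : Fin n → Fin n) (τ-involutive : ∀ x → τ (τ x) ≡ x) where

    Embeds-relabel⁺ : ∀ {H D} → Embeds (relabel H τ) D → Embeds H (D ∘ᶜ τ)
    Embeds-relabel⁺ {H} {D} E = record
      { φ         = τ ∘ φ
      ; injective = λ a b → injective a b ∘ involutive⇒injective {τ = τ} τ-involutive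
      ; clique    = clique
      ; matches   = λ p q → trans (matches p q) (cong₂ _==_ (same p) (same q))
      }
      where
      open Embeds E
      same : ∀ p → imageColour D φ p ≡ imageColour (D ∘ᶜ τ) (τ ∘ φ) p
      same p = sym (trans (colour-∘ᶜ D τ _ _) (cong₂ (colour D) (τ-involutive _) (τ-involutive _)))

    Embeds-relabel⁻ : ∀ {H D} → Embeds H (D ∘ᶜ τ) → Embeds (relabel H τ) D
    Embeds-relabel⁻ {H} {D} E = record
      { φ         = τ ∘ φ
      ; injective = λ a b → injective a b ∘ involutive⇒injective {τ = τ} τ-involutive
      ; clique    = λ a b a≢b →
          subst₂ (λ x y → T (adj H x y)) (sym (τ-involutive _)) (sym (τ-involutive _)) (clique a b a≢b)
      ; matches   = λ p q → trans (matches p q) (cong₂ _==_ (colour-∘ᶜ D τ _ _) (colour-∘ᶜ D τ _ _))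
      }
      where open Embeds E

  -- The tests of `contains`, restated so that `contains k G F c` unfolds to `any goodᵇ (allFuns k (allFin n))`.
  module Containment (G : Graph n) (c : Coloring (suc r) G) where

    injectiveᵇ cliqueᵇ matchesᵇ goodᵇ : (Fin k → Fin n) → Bool
    injectiveᵇ φ = all (λ a → all (λ b → (a == b) ∨ not (φ a == φ b)) (allFin k)) (allFin k)
    cliqueᵇ    φ = all (λ a → all (λ b → (a == b) ∨ adj G (φ a) (φ b)) (allFin k)) (allFin k)

    covers : (Fin k → Fin n) → Fin (e G) → Fin (e (K k)) → Bool
    covers φ p′ p = ((x == φ a) ∧ (y == φ b)) ∨ ((x == φ b) ∧ (y == φ a))
      where
      a b : Fin k
      a = proj₁ (ends (K k) p)
      b = proj₂ (ends (K k) p)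
      x y : Fin n
      x = proj₁ (ends G p′)
      y = proj₂ (ends G p′)

    matchesᵇ φ = all (λ p → all (λ q → all (λ p′ → all (λ q′ →
                   not (covers φ p′ p ∧ covers φ q′ q) ∨ ((F p == F q) ⇔ᵇ (c p′ == c q′)))
                   (allFin (e G))) (allFin (e G))) (allFin (e (K k)))) (allFin (e (K k)))

    goodᵇ φ = injectiveᵇ φ ∧ (cliqueᵇ φ ∧ matchesᵇ φ)

    colour-at-edge : ∀ p′ → c p′ ≡ colour (pairColouring G c) (proj₁ (ends G p′)) (proj₂ (ends G p′))
    colour-at-edge p′ = sym (trans (colour-< (pairColouring G c) (ends-< G p′)) (readEdge-ends G c p′))

    covers-colour : ∀ φ p′ p → T (covers φ p′ p) → c p′ ≡ imageColour (pairColouring G c) φ p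
    covers-colour φ p′ p t with to T-∨ t
    ... | inj₁ t₁ = let x≡ , y≡ = to T-∧ t₁ in
      trans (colour-at-edge p′) (cong₂ (colour (pairColouring G c)) (==⇒≡ x≡) (==⇒≡ y≡))
    ... | inj₂ t₂ = let x≡ , y≡ = to T-∧ t₂ in
      trans (colour-at-edge p′) (trans (cong₂ (colour (pairColouring G c)) (==⇒≡ x≡) (==⇒≡ y≡))
                                       (colour-sym (pairColouring G c) _ _))

    covering-edge : ∀ φ → (∀ a b → φ a ≡ φ b → a ≡ b) → (∀ a b → a ≢ b → T (adj G (φ a) (φ b))) →
      ∀ p → Σ (Fin (e G)) λ p′ → T (covers φ p′ p)
    covering-edge φ inj clq p with Fin.<-cmp (φ a) (φ b)
      where
      a b : Fin k
      a = proj₁ (ends (K k) p)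
      b = proj₂ (ends (K k) p)
    ... | tri< φa<φb _ _ =
      let p′ , ends≡ = edgeIndex G φa<φb (clq _ _ (ends-≢ (K k) p)) in
      p′ , from T-∨ (inj₁ (from T-∧ (≡⇒== (cong proj₁ ends≡) , ≡⇒== (cong proj₂ ends≡))))
    ... | tri≈ _ φa≡φb _ = ⊥-elim (ends-≢ (K k) p (inj _ _ φa≡φb))
    ... | tri> _ _ φb<φa =
      let p′ , ends≡ = edgeIndex G φb<φa (clq _ _ (ends-≢ (K k) p ∘ sym)) in
      p′ , from T-∨ (inj₂ (from T-∧ (≡⇒== (cong proj₁ ends≡) , ≡⇒== (cong proj₂ ends≡))))

    matchesᵇ⁻ : ∀ φ → T (matchesᵇ φ) → ∀ p q p′ q′ →
      T (not (covers φ p′ p ∧ covers φ q′ q) ∨ ((F p == F q) ⇔ᵇ (c p′ == c q′)))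
    matchesᵇ⁻ φ t p q p′ q′ =
      all-allFin⁻ _ (all-allFin⁻ _ (all-allFin⁻ _ (all-allFin⁻ _ t p) q) p′) q′

    good-sound : ∀ φ → T (goodᵇ φ) → Embeds G (pairColouring G c)
    good-sound φ t = record { φ = φ ; injective = inj ; clique = clq ; matches = mat }
      where
      t-inj : T (injectiveᵇ φ)
      t-inj = proj₁ (to T-∧ t)
      t-clq : T (cliqueᵇ φ)
      t-clq = proj₁ (to T-∧ (proj₂ (to (T-∧ {injectiveᵇ φ}) t)))
      t-mat : T (matchesᵇ φ)
      t-mat = proj₂ (to T-∧ (proj₂ (to (T-∧ {injectiveᵇ φ}) t)))
      inj : ∀ a b → φ a ≡ φ b → a ≡ b
      inj a b φa≡φb with a ≟ b
      ... | yes a≡b = a≡b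
      ... | no  a≢b = ⊥-elim (to not-==⇔ (to ==-∨⇔ (all-allFin⁻ _ (all-allFin⁻ _ t-inj a) b) a≢b) φa≡φb)
      clq : ∀ a b → a ≢ b → T (adj G (φ a) (φ b))
      clq a b = to ==-∨⇔ (all-allFin⁻ _ (all-allFin⁻ _ t-clq a) b)
      mat : ∀ p q → (F p == F q) ≡ (imageColour (pairColouring G c) φ p == imageColour (pairColouring G c) φ q)
      mat p q with covering-edge φ inj clq p | covering-edge φ inj clq q
      ... | p′ , p′-covers | q′ , q′-covers =
        trans (to ⇔ᵇ-≡ (to not-∨⇔ (matchesᵇ⁻ φ t-mat p q p′ q′) (from T-∧ (p′-covers , q′-covers))))
              (cong₂ _==_ (covers-colour φ p′ p p′-covers) (covers-colour φ q′ q q′-covers))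

    good-complete : (E : Embeds G (pairColouring G c)) → T (goodᵇ (Embeds.φ E))
    good-complete E = from T-∧ (inj , from T-∧ (clq , mat))
      where
      open Embeds E
      inj : T (injectiveᵇ φ)
      inj = all-allFin⁺ _ λ a → all-allFin⁺ _ λ b →
        from ==-∨⇔ λ a≢b → from not-==⇔ (a≢b ∘ injective a b)
      clq : T (cliqueᵇ φ)
      clq = all-allFin⁺ _ λ a → all-allFin⁺ _ λ b → from ==-∨⇔ (clique a b)
      mat : T (matchesᵇ φ)
      mat = all-allFin⁺ _ λ p → all-allFin⁺ _ λ q → all-allFin⁺ _ λ p′ → all-allFin⁺ _ λ q′ →
        from not-∨⇔ λ t → let p′-covers , q′-covers = to T-∧ t in from ⇔ᵇ-≡
          (trans (matches p q) (sym (cong₂ _==_ (covers-colour φ p′ p p′-covers) (covers-colour φ q′ q q′-covers))))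

    contains-sound : T (contains k G F c) → Embeds G (pairColouring G c)
    contains-sound t = let φ , _ , good = find (any⁻ goodᵇ (allFuns k (allFin n)) t) in good-sound φ good

    contains-complete : Embeds G (pairColouring G c) → T (contains k G F c)
    contains-complete E = any⁺ goodᵇ (Any.map (λ {ψ} φ≗ψ → good-complete (reindex E ψ φ≗ψ))
      (allFuns⁺ (λ a b → b ≡ a) k (allFin n) (Embeds.φ E) (λ i → ∈-allFin _)))

  open Containment using (contains-sound; contains-complete)

  c : Graph n → ℕ
  c = numFree (suc r) k F

  embeds? : Graph n → PairColouring n (suc r) → Bool
  embeds? G C = contains k G F (edgeColouring G C)

  embeds?-sound : ∀ {G C} → T (embeds? G C) → Embeds G C
  embeds?-sound {G} {C} t = Embeds-resp-≈ (pairColouring-≈ G _ C (λ _ → refl)) (contains-sound G _ t)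

  embeds?-complete : ∀ {G C} → Embeds G C → T (embeds? G C)
  embeds?-complete {G} {C} E =
    contains-complete G _ (Embeds-resp-≈ (λ x y xy → sym (pairColouring-≈ G _ C (λ _ → refl) x y xy)) E)

  embeds?-≡ : ∀ {G H C D} → (Embeds G C → Embeds H D) → (Embeds H D → Embeds G C) → embeds? G C ≡ embeds? H D
  embeds?-≡ f g = T-⇔⇒≡ (embeds?-complete ∘ f ∘ embeds?-sound) (embeds?-complete ∘ g ∘ embeds?-sound)

  free : Graph n → PairColouring n (suc r) → Bool
  free G C = not (embeds? G C)

  free-cong : ∀ G {C D} → C ≈[ adj G ] D → free G C ≡ free G D
  free-cong G {C} {D} C≈D = cong not (embeds?-≡ (Embeds-resp-≈ {G} C≈D) (Embeds-resp-≈ (λ x y xy → sym (C≈D x y xy))))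

  numFree≡count-free : ∀ G → c G ≡ count (free G) (colourings G)
  numFree≡count-free G = sym (trans (count-map (free G) (pairColouring G) fs) (count-cong _ _ fs λ {c} _ →
    cong not (T-⇔⇒≡ (contains-complete G c ∘ embeds?-sound) (embeds?-complete ∘ contains-sound G c))))
    where fs = allFuns (e G) (allFin (suc r))

  free-≈ᵍ : ∀ {G H} → G ≈ᵍ H → ∀ C → free G C ≡ free H C
  free-≈ᵍ {G} {H} G≈H C = cong not (embeds?-≡ (Embeds-mono {G} {H} {C} (≐⇒⊆ G≈H))
                                              (Embeds-mono {H} {G} {C} (≐⇒⊆ (λ x y → sym (G≈H x y)))))

  free-relabel : ∀ {τ} → (∀ x → τ (τ x) ≡ x) → ∀ G D → free (relabel G τ) D ≡ free G (D ∘ᶜ τ)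
  free-relabel {τ} τ-involutive G D =
    cong not (embeds?-≡ (Embeds-relabel⁺ τ τ-involutive {G} {D}) (Embeds-relabel⁻ τ τ-involutive {G} {D}))

  numFree-cong : ∀ {G H} → G ≈ᵍ H → c G ≡ c H
  numFree-cong {G} {H} G≈H = begin
    c G                              ≡⟨ numFree≡count-free G ⟩
    count (free G) (colourings G)    ≡⟨ count-cong _ _ (colourings G) (λ {C} _ → free-≈ᵍ {G} {H} G≈H C) ⟩
    count (free H) (colourings G)    ≡⟨ count-invariant (≈-setoid (adj H)) (free H) (free-cong H)
                                          (IsExactEnumeration-≈-cong G≈H (colourings-exact G)) (colourings-exact H) ⟩
    count (free H) (colourings H)    ≡⟨ numFree≡count-free H ⟨
    c H                              ∎
    where open ≡-Reasoning

  freeExtensions : Graph n → EdgeSet n → PairColouring n (suc r) → List (PairColouring n (suc r)) → ℕ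
  freeExtensions G′ S₀ χ = count (free G′ ∘ glue S₀ χ)

  free-split : ∀ G {u v} → u ≢ v → adj G u v ≡ false →
    ∀ C → free G C ≡ free (isolate G v) C ∧ free (isolate G u) C
  free-split G {u} {v} u≢v uv∉ C =
    trans (cong not (T-⇔⇒≡ split unsplit)) (not-∨ (embeds? (isolate G v) C) (embeds? (isolate G u) C))
    where
    split : T (embeds? G C) → T (embeds? (isolate G v) C ∨ embeds? (isolate G u) C)
    split t = from T-∨ (Data.Sum.map embeds?-complete embeds?-complete
                (Embeds-split {G} {C} u≢v uv∉ (embeds?-sound t)))
    unsplit : T (embeds? (isolate G v) C ∨ embeds? (isolate G u) C) → T (embeds? G C)
    unsplit t = embeds?-complete ([ Embeds-mono {isolate G v} {G} {C} (λ _ _ → isolate-⊆ G v) ∘ embeds?-sound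
                                  , Embeds-mono {isolate G u} {G} {C} (λ _ _ → isolate-⊆ G u) ∘ embeds?-sound
                                  ]′ (to T-∨ t))

  module _ (G : Graph n) {u v : Fin n} (u≢v : u ≢ v) (uv∉ : adj G u v ≡ false)
           (G₀ Gᵤ Gᵥ : Graph n) (G₀≈ : G₀ ≈ᵍ avoiding G u v) (Gᵤ≈ : Gᵤ ≈ᵍ star G u) (Gᵥ≈ : Gᵥ ≈ᵍ star G v)
           {L₀ Lᵤ Lᵥ : List (PairColouring n (suc r))}
           (L₀-exact : IsExactEnumeration (≈-setoid (adj G₀)) L₀)
           (Lᵤ-exact : IsExactEnumeration (≈-setoid (adj Gᵤ)) Lᵤ)
           (Lᵥ-exact : IsExactEnumeration (≈-setoid (adj Gᵥ)) Lᵥ) where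
    open Regions G u≢v uv∉

    numFree-split : c G ≡ sum (map (λ χ → freeExtensions (isolate G v) (adj G₀) χ Lᵤ *
                                          freeExtensions (isolate G u) (adj G₀) χ Lᵥ) L₀)
    numFree-split = begin
      c G                                    ≡⟨ numFree≡count-free G ⟩
      count (free G) (colourings G)          ≡⟨ count-cong _ _ (colourings G) (λ {C} _ → free-split G u≢v uv∉ C) ⟩
      count (λ C → A C ∧ B C) (colourings G) ≡⟨ count-∧-split (Graph.sym G₀) (Graph.sym Gᵤ)
                                                  (Disjoint-⊆ G₀⊆ Gᵤ⊆ S₀#Sᵤ) (Disjoint-⊆ G₀⊆ Gᵥ⊆ S₀#Sᵥ)
                                                  (Disjoint-⊆ Gᵤ⊆ Gᵥ⊆ Sᵤ#Sᵥ) G-split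
                                                  (colourings-exact G) L₀-exact Lᵤ-exact Lᵥ-exact A B A-cong B-cong ⟩
      sum (map (λ χ → count (A ∘ glue (adj G₀) χ) Lᵤ * count (B ∘ glue (adj G₀) χ) Lᵥ) L₀) ∎
      where
      open ≡-Reasoning
      A B : PairColouring n (suc r) → Bool
      A = free (isolate G v)
      B = free (isolate G u)
      G₀⊆ : adj G₀ ⊆ S₀
      G₀⊆ = ≐⇒⊆ G₀≈
      Gᵤ⊆ : adj Gᵤ ⊆ Sᵤ
      Gᵤ⊆ = ≐⇒⊆ Gᵤ≈
      Gᵥ⊆ : adj Gᵥ ⊆ Sᵥ
      Gᵥ⊆ = ≐⇒⊆ Gᵥ≈
      ⊆G₀ : S₀ ⊆ adj G₀
      ⊆G₀ = ≐⇒⊆ (λ x y → sym (G₀≈ x y))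
      ⊆Gᵤ : Sᵤ ⊆ adj Gᵤ
      ⊆Gᵤ = ≐⇒⊆ (λ x y → sym (Gᵤ≈ x y))
      ⊆Gᵥ : Sᵥ ⊆ adj Gᵥ
      ⊆Gᵥ = ≐⇒⊆ (λ x y → sym (Gᵥ≈ x y))
      A-cong : Congruent _≈[ adj G₀ ∪ adj Gᵤ ]_ _≡_ A
      A-cong = free-cong (isolate G v) ∘ ≈-mono (⊆-trans isolate-v⊆ (∪-mono ⊆G₀ ⊆Gᵤ))
      B-cong : Congruent _≈[ adj G₀ ∪ adj Gᵥ ]_ _≡_ B
      B-cong = free-cong (isolate G u) ∘ ≈-mono (⊆-trans isolate-u⊆ (∪-mono ⊆G₀ ⊆Gᵥ))
      G-split : ∀ x y → adj G x y ≡ (adj G₀ ∪ (adj Gᵤ ∪ adj Gᵥ)) x y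
      G-split x y = trans (adj-split x y) (sym (cong₂ _∨_ (G₀≈ x y) (cong₂ _∨_ (Gᵤ≈ x y) (Gᵥ≈ x y))))

  -- In the clone, G − v is unchanged and G − u is G − v relabelled by the transposition of u and v.
  numFree-clone : ∀ G {u v} (u≢v : u ≢ v) (uv∉ : adj G u v ≡ false) G₀ → G₀ ≈ᵍ avoiding G u v →
    ∀ {L₀} → IsExactEnumeration (≈-setoid (adj G₀)) L₀ →
    c (clone G u v) ≡ sum (map (λ χ → freeExtensions (isolate G v) (adj G₀) χ (colourings (star G u)) *
                                      freeExtensions (isolate G v) (adj G₀) χ (colourings (star G u))) L₀)
  numFree-clone G {u} {v} u≢v uv∉ G₀ G₀≈ {L₀} L₀-exact = begin
    c H
      ≡⟨ numFree-split H u≢v H-uv∉ G₀ (star G u) (relabel (star G u) τ)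
           (λ x y → trans (G₀≈ x y) (sym (avoiding-uv x y))) (λ x y → sym (star-u x y)) (λ x y → sym (star-v x y))
           L₀-exact (colourings-exact (star G u)) (relabel-exact τ τ-involutive (colourings-exact (star G u))) ⟩
    sum (map (λ χ → freeExtensions (isolate H v) S₀ χ Lᵤ *
                    freeExtensions (isolate H u) S₀ χ (map (_∘ᶜ τ) Lᵤ)) L₀)
      ≡⟨ cong sum (map-cong (λ χ → cong₂ _*_ (unchanged χ) (relabelled χ)) L₀) ⟩
    sum (map (λ χ → freeExtensions (isolate G v) S₀ χ Lᵤ * freeExtensions (isolate G v) S₀ χ Lᵤ) L₀) ∎
    where
    open ≡-Reasoning
    open Swap u≢v
    open Clone G u≢v uv∉
    open Regions G u≢v uv∉ using (S₀-vertices)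
    S₀ : EdgeSet n
    S₀ = adj G₀
    Lᵤ : List (PairColouring n (suc r))
    Lᵤ = colourings (star G u)
    τ-fixes : ∀ x y → T (S₀ x y) → τ x ≡ x × τ y ≡ y
    τ-fixes x y xy = let (x≢u , x≢v) , (y≢u , y≢v) = S₀-vertices (subst T (G₀≈ x y) xy) in
      τ-fix x≢u x≢v , τ-fix y≢u y≢v
    unchanged : ∀ χ → freeExtensions (isolate H v) S₀ χ Lᵤ ≡ freeExtensions (isolate G v) S₀ χ Lᵤ
    unchanged χ = count-cong _ _ Lᵤ (λ {α} _ → free-≈ᵍ {isolate H v} {isolate G v} isolate-v (glue S₀ χ α))
    swapped : ∀ χ α → free (isolate H u) (glue S₀ χ (α ∘ᶜ τ)) ≡ free (isolate G v) (glue S₀ χ α)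
    swapped χ α = begin
      free (isolate H u) (glue S₀ χ (α ∘ᶜ τ))
        ≡⟨ free-≈ᵍ {isolate H u} {relabel (isolate G v) τ} isolate-u (glue S₀ χ (α ∘ᶜ τ)) ⟩
      free (relabel (isolate G v) τ) (glue S₀ χ (α ∘ᶜ τ))
        ≡⟨ free-relabel τ-involutive (isolate G v) (glue S₀ χ (α ∘ᶜ τ)) ⟩
      free (isolate G v) (glue S₀ χ (α ∘ᶜ τ) ∘ᶜ τ)
        ≡⟨ free-cong (isolate G v) (λ x y _ → glue-∘ᶜ (Graph.sym G₀) τ-involutive τ-fixes χ α x y) ⟩
      free (isolate G v) (glue S₀ χ α) ∎
    relabelled : ∀ χ → freeExtensions (isolate H u) S₀ χ (map (_∘ᶜ τ) Lᵤ) ≡ freeExtensions (isolate G v) S₀ χ Lᵤ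
    relabelled χ = trans (count-map _ (_∘ᶜ τ) Lᵤ) (count-cong _ _ Lᵤ (λ {α} _ → swapped χ α))

  symmetrization : ∀ G {u v} → u ≢ v → adj G u v ≡ false → 2 * c G ≤ c (clone G u v) + c (clone G v u)
  symmetrization G {u} {v} u≢v uv∉ = begin
    2 * c G
      ≡⟨ cong (2 *_) (numFree-split G u≢v uv∉ (avoiding G u v) (star G u) (star G v)
                       (λ _ _ → refl) (λ _ _ → refl) (λ _ _ → refl)
                       L₀-exact (colourings-exact (star G u)) (colourings-exact (star G v))) ⟩
    2 * sum (map (λ χ → a χ * b χ) L₀)
      ≤⟨ sum-2ab≤a²+b² a b L₀ ⟩
    sum (map (λ χ → a χ * a χ) L₀) + sum (map (λ χ → b χ * b χ) L₀)
      ≡⟨ cong₂ _+_ (numFree-clone G u≢v uv∉ (avoiding G u v) (λ _ _ → refl) L₀-exact)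
                   (numFree-clone G (u≢v ∘ sym) (trans (Graph.sym G v u) uv∉) (avoiding G u v)
                      (avoiding-comm G u v) L₀-exact) ⟨
    c (clone G u v) + c (clone G v u) ∎
    where
    open ℕₚ.≤-Reasoning
    L₀ : List (PairColouring n (suc r))
    L₀ = colourings (avoiding G u v)
    L₀-exact : IsExactEnumeration (≈-setoid (adj (avoiding G u v))) L₀
    L₀-exact = colourings-exact (avoiding G u v)
    a b : PairColouring n (suc r) → ℕ
    a χ = freeExtensions (isolate G v) (adj (avoiding G u v)) χ (colourings (star G u))
    b χ = freeExtensions (isolate G u) (adj (avoiding G u v)) χ (colourings (star G v))

  Extremal-cong : ∀ {G H} → G ≈ᵍ H → Extremal (suc r) k F G → Extremal (suc r) k F H
  Extremal-cong {G} {H} G≈H G-extremal H′ =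
    ℕₚ.≤-trans (G-extremal H′) (ℕₚ.≤-reflexive (numFree-cong {G} {H} G≈H))

  clone-extremal : ∀ {G u v} → u ≢ v → adj G u v ≡ false →
    Extremal (suc r) k F G → Extremal (suc r) k F (clone G u v)
  clone-extremal {G} {u} {v} u≢v uv∉ G-extremal H = ℕₚ.≤-trans (G-extremal H)
    (ℕₚ.+-cancelʳ-≤ (c G) (c G) (c (clone G u v)) (begin
      c G + c G                         ≡⟨ cong (c G +_) (ℕₚ.+-identityʳ (c G)) ⟨
      2 * c G                           ≤⟨ symmetrization G u≢v uv∉ ⟩
      c (clone G u v) + c (clone G v u) ≤⟨ ℕₚ.+-monoʳ-≤ (c (clone G u v)) (G-extremal (clone G v u)) ⟩
      c (clone G u v) + c G             ∎))
    where open ℕₚ.≤-Reasoning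

  module Greedy (G : Graph n) where

    record Partial (j : ℕ) (s : Fin n → Fin n) : Set where
      field
        extremal   : Extremal (suc r) k F (relabel G s)
        settled    : ∀ x → j ≤ toℕ x → s x ≡ x
        closed     : ∀ x → toℕ x ℕ.< j → toℕ (s x) ℕ.< j
        idempotent : ∀ x → toℕ x ℕ.< j → s (s x) ≡ s x
        clique     : ∀ x y → toℕ x ℕ.< j → toℕ y ℕ.< j → s x ≢ s y → T (adj G (s x) (s y))

    start : Extremal (suc r) k F G → Partial 0 id
    start G-extremal = record
      { extremal = Extremal-cong {G} {relabel G id} (λ _ _ → refl) G-extremal
      ; settled = λ _ _ → refl ; closed = λ _ () ; idempotent = λ _ () ; clique = λ _ _ () }

    module Step {j s} (j<n : j ℕ.< n) (P : Partial j s) where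
      open Partial P

      xⱼ : Fin n
      xⱼ = fromℕ< j<n

      below-suc : ∀ {x} → toℕ x ℕ.< suc j → toℕ x ℕ.< j ⊎ x ≡ xⱼ
      below-suc x<1+j = Data.Sum.map₂ (λ x≡j → Fin.toℕ-injective (trans x≡j (sym (Fin.toℕ-fromℕ< j<n))))
                                      (ℕₚ.m<1+n⇒m<n∨m≡n x<1+j)

      below-≢ : ∀ {x} → toℕ x ℕ.< j → x ≢ xⱼ
      below-≢ x<j refl = ℕₚ.<-irrefl (Fin.toℕ-fromℕ< j<n) x<j

      s-xⱼ : s xⱼ ≡ xⱼ
      s-xⱼ = settled xⱼ (ℕₚ.≤-reflexive (sym (Fin.toℕ-fromℕ< j<n)))

      adjacent-step : (∀ y → toℕ y ℕ.< j → T (adj G (s y) xⱼ)) → Partial (suc j) s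
      adjacent-step adjacent = record
        { extremal   = extremal
        ; settled    = λ x 1+j≤x → settled x (ℕₚ.≤-trans (ℕₚ.n≤1+n j) 1+j≤x)
        ; closed     = λ x x<1+j → [ ℕₚ.m<n⇒m<1+n ∘ closed x , (λ { refl → xⱼ-closed }) ]′ (below-suc x<1+j)
        ; idempotent = λ x x<1+j → [ idempotent x , (λ { refl → cong s s-xⱼ }) ]′ (below-suc x<1+j)
        ; clique     = λ x y x<1+j y<1+j → clique′ (below-suc x<1+j) (below-suc y<1+j)
        }
        where
        xⱼ-closed : toℕ (s xⱼ) ℕ.< suc j
        xⱼ-closed = subst (ℕ._< suc j) (sym (trans (cong toℕ s-xⱼ) (Fin.toℕ-fromℕ< j<n))) (ℕₚ.n<1+n j)
        clique′ : ∀ {x y} → toℕ x ℕ.< j ⊎ x ≡ xⱼ → toℕ y ℕ.< j ⊎ y ≡ xⱼ → s x ≢ s y → T (adj G (s x) (s y))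
        clique′ (inj₁ x<j) (inj₁ y<j) = clique _ _ x<j y<j
        clique′ {x} (inj₁ x<j) (inj₂ refl) _ = subst (T ∘ adj G (s x)) (sym s-xⱼ) (adjacent x x<j)
        clique′ {y = y} (inj₂ refl) (inj₁ y<j) _ =
          subst (λ z → T (adj G z (s y))) (sym s-xⱼ) (subst T (Graph.sym G (s y) xⱼ) (adjacent y y<j))
        clique′ (inj₂ refl) (inj₂ refl) sx≢sx = ⊥-elim (sx≢sx refl)

      clone-step : ∀ y → toℕ y ℕ.< j → adj G (s y) xⱼ ≡ false → Partial (suc j) (s ∘ replace xⱼ (s y))
      clone-step y y<j yxⱼ∉ = record
        { extremal   = clone-extremal {relabel G s} q≢xⱼ (trans (cong₂ (adj G) (idempotent y y<j) s-xⱼ) yxⱼ∉)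
                                      extremal
        ; settled    = λ x 1+j≤x →
            trans (cong s (replace-≢ (λ { refl → ℕₚ.<-irrefl (sym (Fin.toℕ-fromℕ< j<n)) 1+j≤x })))
                  (settled x (ℕₚ.≤-trans (ℕₚ.n≤1+n j) 1+j≤x))
        ; closed     = λ x x<1+j → let z , z<j , s′x≡sz = representative x<1+j in
                         subst (λ w → toℕ w ℕ.< suc j) (sym s′x≡sz) (ℕₚ.m<n⇒m<1+n (closed z z<j))
        ; idempotent = λ x x<1+j → let z , z<j , s′x≡sz = representative x<1+j in
                         trans (cong s′ s′x≡sz) (trans (cong s (replace-≢ (below-≢ (closed z z<j))))
                                                       (trans (idempotent z z<j) (sym s′x≡sz)))
        ; clique     = λ x x′ x<1+j x′<1+j s′x≢s′x′ →
                         let z , z<j , s′x≡sz = representative x<1+j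
                             z′ , z′<j , s′x′≡sz′ = representative x′<1+j
                         in subst₂ (λ a b → T (adj G a b)) (sym s′x≡sz) (sym s′x′≡sz′) (clique z z′ z<j z′<j
                              (λ sz≡sz′ → s′x≢s′x′ (trans s′x≡sz (trans sz≡sz′ (sym s′x′≡sz′)))))
        }
        where
        q : Fin n
        q = s y
        s′ : Fin n → Fin n
        s′ = s ∘ replace xⱼ q
        q≢xⱼ : q ≢ xⱼ
        q≢xⱼ = below-≢ (closed y y<j)
        representative : ∀ {x} → toℕ x ℕ.< suc j → Σ (Fin n) λ z → toℕ z ℕ.< j × s′ x ≡ s z
        representative {x} x<1+j with below-suc x<1+j
        ... | inj₁ x<j = x , x<j , cong s (replace-≢ (below-≢ x<j))
        ... | inj₂ refl = y , y<j , trans (cong s (replace-≡ {v = xⱼ})) (idempotent y y<j)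

    step : ∀ {j s} → j ℕ.< n → Partial j s → Σ (Fin n → Fin n) (Partial (suc j))
    step {j} {s} j<n P with Fin.any? (λ y → (toℕ y ℕ.<? j) ×-dec (adj G (s y) (Step.xⱼ j<n P) ≟ᵇ false))
    ... | yes (y , y<j , yxⱼ∉) = _ , Step.clone-step j<n P y y<j yxⱼ∉
    ... | no  no-non-neighbour = s , Step.adjacent-step j<n P adjacent
      where
      adjacent : ∀ y → toℕ y ℕ.< j → T (adj G (s y) (Step.xⱼ j<n P))
      adjacent y y<j with adj G (s y) (Step.xⱼ j<n P) in yxⱼ
      ... | true  = _
      ... | false = no-non-neighbour (y , y<j , yxⱼ)

    build : Extremal (suc r) k F G → ∀ j → j ≤ n → Σ (Fin n → Fin n) (Partial j)
    build G-extremal zero    _     = id , start G-extremal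
    build G-extremal (suc j) 1+j≤n =
      step 1+j≤n (proj₂ (build G-extremal j (ℕₚ.≤-trans (ℕₚ.n≤1+n j) 1+j≤n)))

    relabel-completeMultipartite : ∀ {s} → Partial n s → CompleteMultipartite (relabel G s)
    relabel-completeMultipartite {s} P = n , s , λ x y → T-⇔⇒≡
      (λ sxsy → from not-==⇔ λ sx≡sy → subst T (trans (cong (adj G (s x)) (sym sx≡sy)) (irrefl G (s x))) sxsy)
      (clique x y (Fin.toℕ<n x) (Fin.toℕ<n y) ∘ to not-==⇔)
      where open Partial P

  extremal-exists : Σ (Graph n) (Extremal (suc r) k F)
  extremal-exists = argmax c empty graphs , λ H → let G , G∈ , G≈H = graphs-complete H in
    ℕₚ.≤-trans (ℕₚ.≤-reflexive (numFree-cong {H} {G} (λ x y → sym (G≈H x y))))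
               (All.lookup (f[xs]≤f[argmax] {f = c} empty graphs) G∈)
    where
    empty : Graph n
    empty = graphOf (λ _ _ → false)

  extremal-completeMultipartite : Σ (Graph n) λ G → CompleteMultipartite G × Extremal (suc r) k F G
  extremal-completeMultipartite =
    let G , G-extremal = extremal-exists
        s , P = Greedy.build G G-extremal n ℕₚ.≤-refl
    in relabel G s , Greedy.relabel-completeMultipartite G P , Greedy.Partial.extremal P

-- Only r ≥ 1 is used, to have a junk colour; the bounds r ≥ 2 and k ≥ 3 play no role.
theorem1p1 : (r k : ℕ) → 2 ≤ r → 3 ≤ k → (F : Coloring r (K k)) → (n : ℕ) →
    Σ (Graph n) (λ G → CompleteMultipartite G × Extremal r k F G)
theorem1p1 (suc r) k _ _ F n = extremal-completeMultipartite {n} {r} {k} F
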